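{- Let $\ell\ge1$. There exists a function $g$ from the set of $k$-tuples of partitions with $\ell$ parts to $\mathbb Z_{\ge0}$ such that $$\mathcal L_{\boldsymbol\lambda/\boldsymbol\mu}(x;t)=t^{g(\boldsymbol\lambda)-g(\boldsymbol\mu)}\,\mathcal L^P_{\boldsymbol\lambda'/\boldsymbol\mu'}(x;t^{ -1})$$ for all $k$-tuples $\boldsymbol\lambda,\boldsymbol\mu$ of partitions with $\ell$ parts such that $\lambda^{(a)}/\mu^{(a)}$ is a horizontal strip for every $a$ (i.e. $\lambda^{(a)}_1\ge\mu^{(a)}_1\ge\lambda^{(a)}_2\ge\mu^{(a)}_2\ge\cdots$).
   Context: Fix an integer $k\ge1$ (colours $1,\dots,k$) and an indeterminate $t$. For $\mathbf I\in\{0,1\}^k$ let $|\mathbf I|=\sum_cI_c$, and for $\mathbf I,\mathbf J\in\mathbb Z^k$ let $\varphi(\mathbf I,\mathbf J)=\sum_{1\le c<d\le k}I_cJ_d$. A vertex is a unit square whose bottom, left, top, right edges carry labels $\mathbf I,\mathbf J,\mathbf K,\mathbf L\in\{0,1\}^k$; $I_c=1$ means a path of colour $c$ uses that edge (paths move up and right). White weight: $W_x(\mathbf I,\mathbf J,\mathbf K,\mathbf L)=\mathbf 1_{\mathbf I+\mathbf J=\mathbf K+\mathbf L}\prod_c\mathbf 1_{I_c+J_c\ne2}\,x^{|\mathbf L|}t^{\varphi(\mathbf L,\mathbf I+\mathbf J)}$; purple weight: $P_x(\mathbf I,\mathbf J,\mathbf K,\mathbf L)=\mathbf 1_{\mathbf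 I+\mathbf J=\mathbf K+\mathbf L}\prod_c\mathbf 1_{K_c\ge J_c}\,x^{|\mathbf L|}t^{\varphi(\mathbf L,\mathbf K-\mathbf J)}$. For $k$-tuples of partitions $\boldsymbol\lambda,\boldsymbol\mu$, each regarded as having $L$ parts ($L$ at least the number of nonzero parts involved), $\mathcal L_{\boldsymbol\lambda/\boldsymbol\mu}(x;t)$ (resp. $\mathcal L^P_{\boldsymbol\lambda/\boldsymbol\mu}(x;t)$) is the partition function of a single white (resp. purple) row with parameter $x$ and columns $-L,\dots,N$ ($N$ large): the bottom boundary edge of column $c$ carries colour $a$ iff $c=\mu^{(a)}_j-j$ for some $j$, the top boundary edge carries colour $a$ iff $c=\lambda^{(a)}_j-j$ for some $j$, left/right boundary edges empty; the partition function is the sum over labellings of internal edges of the product of vertex weights. Conjugation: $\boldsymbol\lambda'=((\lambda^{(k)})',\dots,(\lambda^{(1)})')$, $\rho'$ the conjugate partition. -}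

module Defs where

open import Data.Nat as ℕ using (ℕ; zero; suc; _≤_; _∸_)
open import Data.Integer as ℤ using (ℤ; +_)
open import Data.Fin using (Fin; opposite)
open import Data.Vec as V using (Vec; []; _∷_)
open import Data.List as List using (List; []; _∷_; concatMap)
open import Data.Bool using (Bool; true; false; if_then_else_; _∧_; _∨_)
open import Data.Maybe using (Maybe; just; nothing)
open import Data.Product using (_×_; _,_)
open import Relation.Nullary.Decidable using (⌊_⌋)

-- Edge labels: elements of {0,1}^k, encoded as vectors of naturals with
-- entries in {0,1} (only such vectors are ever enumerated).

Label : ℕ → Set
Label k = Vec ℕ k

emptyLabel : ∀ k → Label k
emptyLabel k = V.replicate k 0

allLabels : ∀ k → List (Label k)
allLabels zero    = [] ∷ []
allLabels (suc k) = concatMap (λ v → (0 ∷ v) ∷ (1 ∷ v) ∷ []) (allLabels k)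

size : ∀ {k} → Label k → ℕ
size = V.sum

φ : ∀ {k} → Vec ℕ k → Vec ℕ k → ℕ
φ []      []      = 0
φ (i ∷ I) (j ∷ J) = i ℕ.* V.sum J ℕ.+ φ I J

_==ᵛ_ : ∀ {k} → Vec ℕ k → Vec ℕ k → Bool
[]      ==ᵛ []      = true
(a ∷ u) ==ᵛ (b ∷ v) = ⌊ a ℕ.≟ b ⌋ ∧ (u ==ᵛ v)

allᵛ : ∀ {k} → (ℕ → ℕ → Bool) → Vec ℕ k → Vec ℕ k → Bool
allᵛ p []      []      = true
allᵛ p (a ∷ u) (b ∷ v) = p a b ∧ allᵛ p u v

-- Laurent polynomials in x, t (polynomial in x) with natural-number
-- coefficients, represented as a formal sum (list) of monomials
-- x^a t^b, a monomial being the pair (a , b).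

Mono : Set
Mono = ℕ × ℤ

Poly : Set
Poly = List Mono

_*ᵐ_ : Mono → Mono → Mono
(a , b) *ᵐ (c , d) = (a ℕ.+ c , b ℤ.+ d)

coeff : Poly → ℕ → ℤ → ℕ
coeff []              a b = 0
coeff ((c , d) ∷ ps)  a b =
  (if ⌊ c ℕ.≟ a ⌋ ∧ ⌊ d ℤ.≟ b ⌋ then 1 else 0) ℕ.+ coeff ps a b

_≈ᴾ_ : Poly → Poly → Set
P ≈ᴾ Q = ∀ a b → coeff P a b ≡ coeff Q a b
  where open import Relation.Binary.PropositionalEquality using (_≡_)

shiftInvT : ℤ → Poly → Poly
shiftInvT n = List.map (λ { (a , b) → (a , n ℤ.- b) })

-- Vertex weights. A weight returns `nothing` when it vanishes and
-- `just (a , b)` when it equals x^a t^b.  Arguments: I (bottom), J (left),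
-- K (top), L (right).

VertexWeight : ℕ → Set
VertexWeight k = Label k → Label k → Label k → Label k → Maybe Mono

white : ∀ {k} → VertexWeight k
white I J K L =
  if (V.zipWith ℕ._+_ I J ==ᵛ V.zipWith ℕ._+_ K L)
     ∧ allᵛ (λ i j → Data.Bool.not ⌊ i ℕ.+ j ℕ.≟ 2 ⌋) I J
  then just (size L , + φ L (V.zipWith ℕ._+_ I J))
  else nothing
  where import Data.Bool

purple : ∀ {k} → VertexWeight k
purple I J K L =
  if (V.zipWith ℕ._+_ I J ==ᵛ V.zipWith ℕ._+_ K L)
     ∧ allᵛ (λ kc jc → ⌊ jc ℕ.≤? kc ⌋) K J
  then just (size L , + φ L (V.zipWith _∸_ K J))
  else nothing

-- The columns are given from left
-- to right as pairs (bottom label , top label); J is the label of the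
-- left edge of the first column.  We sum over the labels of all
-- horizontal edges; the right boundary edge of the last column must be
-- empty.

rowPF : ∀ {k} → VertexWeight k → Label k → List (Label k × Label k) → Poly
rowPF {k} w J []              =
  if J ==ᵛ emptyLabel k then (0 , + 0) ∷ [] else []
rowPF {k} w J ((I , K) ∷ cs)  =
  concatMap (λ L → step (w I J K L) (rowPF w L cs)) (allLabels k)
  where
  step : Maybe Mono → Poly → Poly
  step nothing  _ = []
  step (just m) P = List.map (m *ᵐ_) P

-- Partitions.  A partition with ℓ parts is a weakly decreasing vector of
-- ℓ naturals (zero parts allowed).  `part v j` is the j-th part (1-indexed),
-- 0 for j = 0 or j > ℓ.

part : ∀ {ℓ} → Vec ℕ ℓ → ℕ → ℕ
part []      _             = 0
part (x ∷ v) zero          = 0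
part (x ∷ v) (suc zero)    = x
part (x ∷ v) (suc (suc j)) = part v (suc j)

IsPartition : ∀ {ℓ} → Vec ℕ ℓ → Set
IsPartition v = ∀ j → part v (suc (suc j)) ≤ part v (suc j)

HorizontalStrip : ∀ {ℓ} → Vec ℕ ℓ → Vec ℕ ℓ → Set
HorizontalStrip lam mu =
  ∀ j → part mu (suc j) ≤ part lam (suc j) × part lam (suc (suc j)) ≤ part mu (suc j)

-- k-tuples of partitions, given through their part functions j ↦ ρ_j (j ≥ 1)
PartFun : Set
PartFun = ℕ → ℕ

Tuple : ℕ → Set
Tuple k = Fin k → PartFun

asTuple : ∀ {k ℓ} → (Fin k → Vec ℕ ℓ) → Tuple k
asTuple lam a = part (lam a)

conj : ∀ {ℓ} → Vec ℕ ℓ → PartFun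
conj v i = List.length (List.filter (λ x → i ℕ.≤? x) (V.toList v))

conjTuple : ∀ {k ℓ} → (Fin k → Vec ℕ ℓ) → Tuple k
conjTuple lam a = conj (lam (opposite a))

occupied : PartFun → ℕ → ℤ → Bool
occupied ρ zero    c = false
occupied ρ (suc j) c = ⌊ c ℤ.≟ (+ ρ (suc j) ℤ.- + suc j) ⌋ ∨ occupied ρ j c

-- label of the column c for the tuple ρ regarded as having L parts
boundaryLabel : ∀ {k} → Tuple k → ℕ → ℤ → Label k
boundaryLabel ρ L c = V.tabulate (λ a → if occupied (ρ a) L c then 1 else 0)

intRange : ℤ → ℕ → List ℤ
intRange s zero    = []
intRange s (suc n) = s ∷ intRange (s ℤ.+ + 1) n

columns : ℕ → ℕ → List ℤ
columns L N = intRange (ℤ.- (+ L)) (L ℕ.+ N ℕ.+ 1)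

rowFunction : ∀ {k} → VertexWeight k → Tuple k → Tuple k → ℕ → ℕ → Poly
rowFunction {k} w lam mu L N =
  rowPF w (emptyLabel k)
    (List.map (λ c → boundaryLabel mu L c , boundaryLabel lam L c) (columns L N))

𝓛 : ∀ {k} → Tuple k → Tuple k → ℕ → ℕ → Poly
𝓛 = rowFunction white

𝓛ᴾ : ∀ {k} → Tuple k → Tuple k → ℕ → ℕ → Poly
𝓛ᴾ = rowFunction purple

{-# OPTIONS --safe #-}
-- Both single-row partition functions consist of exactly one configuration.  In
-- the white row the path of colour a runs, for each j, from the site μ^(a)_j − j
-- of the bottom boundary to the site λ^(a)_j − j of the top boundary.  In the
-- purple row, whose boundaries are the conjugates, the path of colour k+1−a runs
-- over the mirror images of these intervals under x ↦ −1 − x, because the sites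
-- of a partition and the mirrored sites of its conjugate are complementary.  So
-- 𝓛 = x^X t^Y and 𝓛ᴾ = x^X t^Y′ with the same X = Σ_a |λ^(a)| − |μ^(a)|.  For each
-- pair of colours, Y and Y′ are counts of overlaps of these intervals, and a
-- pointwise crossing identity for two intervals turns Y + Y′ into g(λ) − g(μ) with
--   g(ρ) = Σ_{a<b} ( |ρ^(b)| + #{(i,j) : ρ^(b)_i − i < ρ^(a)_j − j} ).

module Submission where

open import Defs
open import Data.Nat using (ℕ; _≤_)
open import Data.Integer using (+_; _-_)
open import Data.Fin using (Fin)
open import Data.Vec using (Vec; lookup)
open import Data.Product using (Σ; _×_)
open import Data.Nat as ℕ using (zero; suc; _+_; _*_; _∸_; _<_; z≤n; s≤s)
import Data.Nat.Properties as ℕP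
import Data.Nat.Tactic.RingSolver as NS
open import Data.Integer as ℤ using (ℤ)
import Data.Integer.Properties as ℤP
open import Data.Integer.Tactic.RingSolver using (solve-∀)
open import Data.Fin as F using ()
open import Data.Vec as V using ([]; _∷_; tabulate)
open import Data.List as List using (List; []; _∷_; concatMap; _++_)
import Data.List.Properties as LP
import Data.Vec.Properties as VP
import Data.Bool.Properties as BP
open import Data.Bool using (Bool; true; false; _∧_; _∨_; if_then_else_; not) renaming (T to Tᵇ)
open import Data.Unit using (tt; ⊤)
open import Data.Maybe using (just; nothing)
open import Data.Product using (_,_; proj₁; proj₂)
open import Data.Sum using (_⊎_; inj₁; inj₂)
open import Relation.Nullary using (Dec; yes; no; does; ¬_)
open import Relation.Nullary.Decidable using (dec-true; dec-false; ⌊_⌋)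
open import Relation.Binary.PropositionalEquality
open import Relation.Binary.Definitions using (tri<; tri≈; tri>)
open import Data.Empty using (⊥-elim)
open import Function using (_∘_)

-- Indicators of integer intervals

bit : Bool → ℕ
bit true = 1
bit false = 0

χ : ℤ → ℤ → ℤ → ℕ
χ p q x = bit (does (p ℤ.≤? x) ∧ does (x ℤP.<? q))

point : ℤ → ℤ → ℕ
point p = χ p (p ℤ.+ + 1)

mirror : ℤ → ℤ
mirror p = ℤ.- + 1 - p

mirror-involutive : ∀ x → mirror (mirror x) ≡ x
mirror-involutive x = ring x
  where ring : ∀ x → ℤ.- + 1 - (ℤ.- + 1 - x) ≡ x
        ring = solve-∀

+-cancelʳ-≤ : ∀ {i j} k → i ℤ.+ k ℤ.≤ j ℤ.+ k → i ℤ.≤ j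
+-cancelʳ-≤ {i} {j} k h = subst₂ ℤ._≤_ (e i k) (e j k) (ℤP.+-monoˡ-≤ (ℤ.- k) h)
  where e : ∀ a k → a ℤ.+ k ℤ.+ ℤ.- k ≡ a
        e = solve-∀

+-cancelʳ-< : ∀ {i j} k → i ℤ.+ k ℤ.< j ℤ.+ k → i ℤ.< j
+-cancelʳ-< {i} {j} k h = subst₂ ℤ._<_ (e i k) (e j k) (ℤP.+-monoˡ-< (ℤ.- k) h)
  where e : ∀ a k → a ℤ.+ k ℤ.+ ℤ.- k ≡ a
        e = solve-∀

<⇒+1≤ : ∀ {i j} → i ℤ.< j → i ℤ.+ + 1 ℤ.≤ j
<⇒+1≤ {i} h = subst₂ ℤ._≤_ (ℤP.+-comm (+ 1) i) refl (ℤP.i<j⇒suc[i]≤j h)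

+1≤⇒< : ∀ {i j} → i ℤ.+ + 1 ℤ.≤ j → i ℤ.< j
+1≤⇒< {i} h = ℤP.suc[i]≤j⇒i<j (subst₂ ℤ._≤_ (ℤP.+-comm i (+ 1)) refl h)

≤⇒<+1 : ∀ {i j} → i ℤ.≤ j → i ℤ.< j ℤ.+ + 1
≤⇒<+1 h = +1≤⇒< (ℤP.+-monoˡ-≤ (+ 1) h)

<+1⇒≤ : ∀ {i j} → i ℤ.< j ℤ.+ + 1 → i ℤ.≤ j
<+1⇒≤ h = +-cancelʳ-≤ (+ 1) (<⇒+1≤ h)

χ-inside : ∀ {p q x} → p ℤ.≤ x → x ℤ.< q → χ p q x ≡ 1
χ-inside {p} {q} {x} a b rewrite dec-true (p ℤ.≤? x) a | dec-true (x ℤP.<? q) b = refl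

χ-below : ∀ {p q x} → x ℤ.< p → χ p q x ≡ 0
χ-below {p} {q} {x} a rewrite dec-false (p ℤ.≤? x) (ℤP.<⇒≱ a) = refl

χ-above : ∀ {p q x} → q ℤ.≤ x → χ p q x ≡ 0
χ-above {p} {q} {x} a rewrite dec-false (x ℤP.<? q) (ℤP.≤⇒≯ a) with does (p ℤ.≤? x)
... | true = refl
... | false = refl

data Position (p q x : ℤ) : Set where
  below : x ℤ.< p → Position p q x
  above : p ℤ.≤ x → q ℤ.≤ x → Position p q x
  inside : p ℤ.≤ x → x ℤ.< q → Position p q x

position? : ∀ p q x → Position p q x
position? p q x with p ℤ.≤? x | x ℤP.<? q
... | no ¬a | _ = below (ℤP.≰⇒> ¬a)
... | yes a | yes b = inside a b
... | yes a | no ¬b = above a (ℤP.≮⇒≥ ¬b)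

χ≤1 : ∀ p q x → χ p q x ≤ 1
χ≤1 p q x with position? p q x
... | below a rewrite χ-below {p} {q} a = z≤n
... | above _ b rewrite χ-above {p} {q} b = z≤n
... | inside a b rewrite χ-inside a b = s≤s z≤n

χ-concat : ∀ {p q r} → p ℤ.≤ q → q ℤ.≤ r → ∀ x → χ p q x + χ q r x ≡ χ p r x
χ-concat {p} {q} {r} pq qr x with position? p q x
... | below a rewrite χ-below {p} {q} a | χ-below {q} {r} (ℤP.<-≤-trans a pq) | χ-below {p} {r} a = refl
... | inside a b rewrite χ-inside a b | χ-below {q} {r} b | χ-inside a (ℤP.<-≤-trans b qr) = refl
... | above a b with position? q r x
...   | below c = ⊥-elim (ℤP.≤⇒≯ b c)
...   | above _ d rewrite χ-above {p} {q} b | χ-above {q} {r} d | χ-above {p} {r} d = refl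
...   | inside c d rewrite χ-above {p} {q} b | χ-inside c d | χ-inside a d = refl

χ-empty : ∀ p x → χ p p x ≡ 0
χ-empty p x with position? p p x
... | below a = χ-below {p} {p} a
... | above _ b = χ-above {p} {p} b
... | inside a b = ⊥-elim (ℤP.≤⇒≯ a b)

χ-cong-⇔ : ∀ {p q x p' q' x'} →
  (p ℤ.≤ x → p' ℤ.≤ x') → (p' ℤ.≤ x' → p ℤ.≤ x) →
  (x ℤ.< q → x' ℤ.< q') → (x' ℤ.< q' → x ℤ.< q) → χ p q x ≡ χ p' q' x'
χ-cong-⇔ {p} {q} {x} {p'} {q'} {x'} f1 f2 g1 g2 with position? p q x
... | below a with position? p' q' x'
...   | below a' rewrite χ-below {p} {q} a | χ-below {p'} {q'} a' = refl
...   | above a' _ = ⊥-elim (ℤP.<⇒≱ a (f2 a'))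
...   | inside a' _ = ⊥-elim (ℤP.<⇒≱ a (f2 a'))
χ-cong-⇔ {p} {q} {x} {p'} {q'} {x'} f1 f2 g1 g2 | above a b with position? p' q' x'
...   | below a' = ⊥-elim (ℤP.<⇒≱ a' (f1 a))
...   | above a' b' rewrite χ-above {p} {q} b | χ-above {p'} {q'} b' = refl
...   | inside a' b' = ⊥-elim (ℤP.≤⇒≯ b (g2 b'))
χ-cong-⇔ {p} {q} {x} {p'} {q'} {x'} f1 f2 g1 g2 | inside a b rewrite χ-inside a b | χ-inside (f1 a) (g1 b) = refl

χ-shift : ∀ p q x → χ p q (x - + 1) ≡ χ (p ℤ.+ + 1) (q ℤ.+ + 1) x
χ-shift p q x = χ-cong-⇔ {p} {q} {x - + 1} {p ℤ.+ + 1} {q ℤ.+ + 1} {x}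
  (λ h → subst₂ ℤ._≤_ refl (e x) (ℤP.+-monoˡ-≤ (+ 1) h))
  (λ h → +-cancelʳ-≤ (+ 1) (subst₂ ℤ._≤_ refl (sym (e x)) h))
  (λ h → subst₂ ℤ._<_ (e x) refl (ℤP.+-monoˡ-< (+ 1) h))
  (λ h → +-cancelʳ-< (+ 1) (subst₂ ℤ._<_ (sym (e x)) refl h))
  where e : ∀ a → a - + 1 ℤ.+ + 1 ≡ a
        e = solve-∀

χ-cross-⇔ : ∀ {p q x p' q' x'} →
  (p ℤ.≤ x → x' ℤ.< q') → (x' ℤ.< q' → p ℤ.≤ x) →
  (x ℤ.< q → p' ℤ.≤ x') → (p' ℤ.≤ x' → x ℤ.< q) → χ p q x ≡ χ p' q' x'
χ-cross-⇔ {p} {q} {x} {p'} {q'} {x'} f1 f2 g1 g2 with position? p q x | position? p' q' x'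
... | below a | below a' rewrite χ-below {p} {q} a | χ-below {p'} {q'} a' = refl
... | below a | above a' b' rewrite χ-below {p} {q} a | χ-above {p'} {q'} b' = refl
... | below a | inside a' b' = ⊥-elim (ℤP.<⇒≱ a (f2 b'))
... | above a b | below a' rewrite χ-above {p} {q} b | χ-below {p'} {q'} a' = refl
... | above a b | above a' b' rewrite χ-above {p} {q} b | χ-above {p'} {q'} b' = refl
... | above a b | inside a' b' = ⊥-elim (ℤP.≤⇒≯ b (g2 a'))
... | inside a b | below a' = ⊥-elim (ℤP.<⇒≱ a' (g1 b))
... | inside a b | above a' b' = ⊥-elim (ℤP.≤⇒≯ b' (f1 a))
... | inside a b | inside a' b' rewrite χ-inside a b | χ-inside a' b' = refl

χ-mirror : ∀ p q x → χ p q (mirror x) ≡ χ (ℤ.- q) (ℤ.- p) x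
χ-mirror p q x = χ-cross-⇔ {p} {q} {ℤ.- + 1 - x} {ℤ.- q} {ℤ.- p} {x} f1 f2 g1 g2
  where
  f1 : p ℤ.≤ ℤ.- + 1 - x → x ℤ.< ℤ.- p
  f1 h = +1≤⇒< (subst₂ ℤ._≤_ (e1 p x) refl (ℤP.neg-mono-≤ h))
    where e1 : ∀ p x → ℤ.- (ℤ.- + 1 - x) ≡ x ℤ.+ + 1
          e1 = solve-∀
  f2 : x ℤ.< ℤ.- p → p ℤ.≤ ℤ.- + 1 - x
  f2 h = ℤP.neg-cancel-≤ (subst₂ ℤ._≤_ (sym (e1 p x)) refl (<⇒+1≤ h))
    where e1 : ∀ p x → ℤ.- (ℤ.- + 1 - x) ≡ x ℤ.+ + 1
          e1 = solve-∀
  g1 : ℤ.- + 1 - x ℤ.< q → ℤ.- q ℤ.≤ x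
  g1 h = subst₂ ℤ._≤_ (e2 q x) (e3 q x) (ℤP.+-monoˡ-≤ (x - q) (<⇒+1≤ h))
    where e2 : ∀ q x → ℤ.- + 1 - x ℤ.+ + 1 ℤ.+ (x - q) ≡ ℤ.- q
          e2 = solve-∀
          e3 : ∀ q x → q ℤ.+ (x - q) ≡ x
          e3 = solve-∀
  g2 : ℤ.- q ℤ.≤ x → ℤ.- + 1 - x ℤ.< q
  g2 h = +1≤⇒< (subst₂ ℤ._≤_ (e2 q x) (e3 q x) (ℤP.+-monoˡ-≤ (q - x) h))
    where e2 : ∀ q x → ℤ.- q ℤ.+ (q - x) ≡ ℤ.- + 1 - x ℤ.+ + 1
          e2 = solve-∀
          e3 : ∀ q x → x ℤ.+ (q - x) ≡ q
          e3 = solve-∀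

sumL : (ℤ → ℕ) → List ℤ → ℕ
sumL f [] = 0
sumL f (x ∷ xs) = f x + sumL f xs

-- Finite sums

+-middle-swap : ∀ a b c d → a + b + (c + d) ≡ a + c + (b + d)
+-middle-swap = NS.solve-∀

+-right-swap : ∀ a b c → a + b + c ≡ a + c + b
+-right-swap = NS.solve-∀

sumL-+ : ∀ (f g : ℤ → ℕ) xs → sumL (λ x → f x + g x) xs ≡ sumL f xs + sumL g xs
sumL-+ f g [] = refl
sumL-+ f g (x ∷ xs) rewrite sumL-+ f g xs = +-middle-swap (f x) (g x) (sumL f xs) (sumL g xs)

sumL-cong : ∀ {f g : ℤ → ℕ} xs → (∀ x → f x ≡ g x) → sumL f xs ≡ sumL g xs
sumL-cong [] e = refl
sumL-cong (x ∷ xs) e = cong₂ _+_ (e x) (sumL-cong xs e)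

i+1+n≡i+[1+n] : ∀ s n → s ℤ.+ + 1 ℤ.+ + n ≡ s ℤ.+ + suc n
i+1+n≡i+[1+n] s n = ℤP.+-assoc s (+ 1) (+ n)

InRange : ℤ → ℕ → ℤ → Set
InRange s n x = (s ℤ.≤ x) × (x ℤ.< s ℤ.+ + n)

InRange-tail : ∀ s n x → InRange (s ℤ.+ + 1) n x → InRange s (suc n) x
InRange-tail s n x (a , b) = ℤP.≤-trans (ℤP.i≤i+j s (+ 1)) a , subst₂ ℤ._<_ refl (i+1+n≡i+[1+n] s n) b

InRange-head : ∀ s n → InRange s (suc n) s
InRange-head s n = ℤP.≤-refl , subst₂ ℤ._<_ (ℤP.+-identityʳ s) refl (ℤP.+-monoʳ-< s (ℤ.+<+ (s≤s z≤n)))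

sumL-cong-range : ∀ {f g : ℤ → ℕ} s n → (∀ x → InRange s n x → f x ≡ g x) →
  sumL f (intRange s n) ≡ sumL g (intRange s n)
sumL-cong-range s zero e = refl
sumL-cong-range s (suc n) e = cong₂ _+_ (e s (InRange-head s n)) (sumL-cong-range (s ℤ.+ + 1) n (λ x h → e x (InRange-tail s n x h)))

sumL-zero : ∀ xs → sumL (λ _ → 0) xs ≡ 0
sumL-zero [] = refl
sumL-zero (x ∷ xs) = sumL-zero xs

sumL-zero-range : ∀ {f : ℤ → ℕ} s n → (∀ x → InRange s n x → f x ≡ 0) → sumL f (intRange s n) ≡ 0
sumL-zero-range s n e = trans (sumL-cong-range s n e) (sumL-zero (intRange s n))

sumL-one : ∀ s m → sumL (λ _ → 1) (intRange s m) ≡ m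
sumL-one s zero = refl
sumL-one s (suc m) = cong suc (sumL-one (s ℤ.+ + 1) m)

i+m≤i⇒m≡0 : ∀ p m → p ℤ.+ + m ℤ.≤ p → m ≡ 0
i+m≤i⇒m≡0 p zero h = refl
i+m≤i⇒m≡0 p (suc m) h = ⊥-elim (ℤP.<⇒≱ (subst₂ ℤ._<_ (ℤP.+-identityʳ p) refl (ℤP.+-monoʳ-< p (ℤ.+<+ (s≤s z≤n)))) h)

≤⇒<⊎≡ : ∀ {i j} → i ℤ.≤ j → (i ℤ.< j) ⊎ (i ≡ j)
≤⇒<⊎≡ {i} {j} h with i ℤ.≟ j
... | yes e = inj₂ e
... | no ne = inj₁ (ℤP.≤∧≢⇒< h ne)

sumL-χ-restrict : ∀ (f : ℤ → ℕ) s n p m → s ℤ.≤ p → p ℤ.+ + m ℤ.≤ s ℤ.+ + n →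
  sumL (λ x → χ p (p ℤ.+ + m) x * f x) (intRange s n) ≡ sumL f (intRange p m)
sumL-χ-restrict f s zero p m sp h with i+m≤i⇒m≡0 p m (ℤP.≤-trans h (subst₂ ℤ._≤_ (sym (ℤP.+-identityʳ s)) refl sp))
... | refl = refl
sumL-χ-restrict f s (suc n) p m sp h with ≤⇒<⊎≡ sp
... | inj₁ s<p rewrite χ-below {p} {p ℤ.+ + m} s<p =
  sumL-χ-restrict f (s ℤ.+ + 1) n p m (<⇒+1≤ s<p) (subst₂ ℤ._≤_ refl (sym (i+1+n≡i+[1+n] s n)) h)
... | inj₂ refl with m
...   | zero = sumL-zero-range s (suc n) (λ x _ → cong (_* f x) (trans (cong (λ z → χ s z x) (ℤP.+-identityʳ s)) (χ-empty s x)))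
...   | suc m' rewrite χ-inside {s} {s ℤ.+ + suc m'} {s} ℤP.≤-refl (proj₂ (InRange-head s m')) =
   cong₂ _+_ (ℕP.*-identityˡ (f s)) (trans
     (sumL-cong-range (s ℤ.+ + 1) n (λ x hx → cong (_* f x) (χ-tail x (proj₁ hx))))
     (sumL-χ-restrict f (s ℤ.+ + 1) n (s ℤ.+ + 1) m' ℤP.≤-refl (subst₂ ℤ._≤_ (sym (i+1+n≡i+[1+n] s m')) (sym (i+1+n≡i+[1+n] s n)) h)))
   where
   χ-tail : ∀ x → s ℤ.+ + 1 ℤ.≤ x → χ s (s ℤ.+ + suc m') x ≡ χ (s ℤ.+ + 1) (s ℤ.+ + 1 ℤ.+ + m') x
   χ-tail x hx = χ-cong-⇔ {s} {s ℤ.+ + suc m'} {x} {s ℤ.+ + 1} {s ℤ.+ + 1 ℤ.+ + m'} {x}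
     (λ _ → hx) (λ _ → ℤP.≤-trans (ℤP.i≤i+j s (+ 1)) hx)
     (λ h' → subst₂ ℤ._<_ refl (sym (i+1+n≡i+[1+n] s m')) h') (λ h' → subst₂ ℤ._<_ refl (i+1+n≡i+[1+n] s m') h')

sumL-point : ∀ (f : ℤ → ℕ) s n p → s ℤ.≤ p → p ℤ.< s ℤ.+ + n →
  sumL (λ x → f x * point p x) (intRange s n) ≡ f p
sumL-point f s n p s≤p p<s+n = begin
  sumL (λ x → f x * point p x) (intRange s n) ≡⟨ sumL-cong (intRange s n) (λ x → ℕP.*-comm (f x) (point p x)) ⟩
  sumL (λ x → point p x * f x) (intRange s n) ≡⟨ sumL-χ-restrict f s n p 1 s≤p (<⇒+1≤ p<s+n) ⟩
  f p + 0                                     ≡⟨ ℕP.+-identityʳ (f p) ⟩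
  f p                                         ∎
  where open ≡-Reasoning

sumL-χ-length : ∀ s n p m → s ℤ.≤ p → p ℤ.+ + m ℤ.≤ s ℤ.+ + n → sumL (χ p (p ℤ.+ + m)) (intRange s n) ≡ m
sumL-χ-length s n p m h1 h2 = trans (sumL-cong (intRange s n) (λ x → sym (ℕP.*-identityʳ (χ p (p ℤ.+ + m) x))))
  (trans (sumL-χ-restrict (λ _ → 1) s n p m h1 h2) (sumL-one p m))

sumL-snoc : ∀ (g : ℤ → ℕ) t m → sumL g (intRange t (suc m)) ≡ sumL g (intRange t m) + g (t ℤ.+ + m)
sumL-snoc g t zero = trans (ℕP.+-identityʳ (g t)) (cong g (sym (ℤP.+-identityʳ t)))
sumL-snoc g t (suc m) rewrite sumL-snoc g (t ℤ.+ + 1) m =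
  trans (sym (ℕP.+-assoc (g t) _ _)) (cong (λ z → g t + sumL g (intRange (t ℤ.+ + 1) m) + g z) (i+1+n≡i+[1+n] t m))

sumL-mirror : ∀ (f : ℤ → ℕ) p m →
  sumL f (intRange p m) ≡ sumL (f ∘ mirror) (intRange (ℤ.- p - + m) m)
sumL-mirror f p zero = refl
sumL-mirror f p (suc m) rewrite sumL-mirror f (p ℤ.+ + 1) m
  | sumL-snoc (f ∘ mirror) (ℤ.- p - + suc m) m =
  trans (ℕP.+-comm (f p) _) (cong₂ _+_ (cong (λ z → sumL (f ∘ mirror) (intRange z m)) (e1 p (+ m)))
     (cong f (e2 p (+ m))))
  where
  e1 : ∀ p m → ℤ.- (p ℤ.+ + 1) - m ≡ ℤ.- p - (+ 1 ℤ.+ m)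
  e1 = solve-∀
  e2 : ∀ p m → p ≡ ℤ.- + 1 - (ℤ.- p - (+ 1 ℤ.+ m) ℤ.+ m)
  e2 = solve-∀

sumN : ℕ → (ℕ → ℕ) → ℕ
sumN zero f = 0
sumN (suc n) f = f (suc n) + sumN n f

sumN-+ : ∀ n (f g : ℕ → ℕ) → sumN n (λ j → f j + g j) ≡ sumN n f + sumN n g
sumN-+ zero f g = refl
sumN-+ (suc n) f g rewrite sumN-+ n f g = +-middle-swap (f (suc n)) (g (suc n)) (sumN n f) (sumN n g)

sumN-*ˡ : ∀ n c (f : ℕ → ℕ) → sumN n (λ j → c * f j) ≡ c * sumN n f
sumN-*ˡ zero c f = sym (ℕP.*-zeroʳ c)
sumN-*ˡ (suc n) c f rewrite sumN-*ˡ n c f = sym (ℕP.*-distribˡ-+ c (f (suc n)) (sumN n f))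

sumN-*ʳ : ∀ n c (f : ℕ → ℕ) → sumN n (λ j → f j * c) ≡ sumN n f * c
sumN-*ʳ zero c f = refl
sumN-*ʳ (suc n) c f rewrite sumN-*ʳ n c f = sym (ℕP.*-distribʳ-+ c (f (suc n)) (sumN n f))

sumN-cong : ∀ n {f g : ℕ → ℕ} → (∀ j → 1 ≤ j → j ≤ n → f j ≡ g j) → sumN n f ≡ sumN n g
sumN-cong zero e = refl
sumN-cong (suc n) e = cong₂ _+_ (e (suc n) (s≤s z≤n) ℕP.≤-refl) (sumN-cong n (λ j a b → e j a (ℕP.m≤n⇒m≤1+n b)))

sumN-0 : ∀ n {f : ℕ → ℕ} → (∀ j → 1 ≤ j → j ≤ n → f j ≡ 0) → sumN n f ≡ 0
sumN-0 zero e = refl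
sumN-0 (suc n) e = cong₂ _+_ (e (suc n) (s≤s z≤n) ℕP.≤-refl) (sumN-0 n (λ j a b → e j a (ℕP.m≤n⇒m≤1+n b)))

sumN-swap : ∀ n m (F : ℕ → ℕ → ℕ) → sumN n (λ i → sumN m (λ j → F i j)) ≡ sumN m (λ j → sumN n (λ i → F i j))
sumN-swap zero m F = sym (sumN-0 m (λ _ _ _ → refl))
sumN-swap (suc n) m F rewrite sumN-swap n m F = sym (sumN-+ m (λ j → F (suc n) j) (λ j → sumN n (λ i → F i j)))

sumL-sumN : ∀ n (F : ℕ → ℤ → ℕ) xs → sumL (λ x → sumN n (λ j → F j x)) xs ≡ sumN n (λ j → sumL (F j) xs)
sumL-sumN n F [] = sym (sumN-0 n (λ _ _ _ → refl))
sumL-sumN n F (x ∷ xs) rewrite sumL-sumN n F xs = sym (sumN-+ n (λ j → F j x) (λ j → sumL (F j) xs))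

ΣFin : ∀ k → (Fin k → ℕ) → ℕ
ΣFin zero f = 0
ΣFin (suc k) f = f F.zero + ΣFin k (λ a → f (F.suc a))

ΣFin-+ : ∀ k (f g : Fin k → ℕ) → ΣFin k (λ a → f a + g a) ≡ ΣFin k f + ΣFin k g
ΣFin-+ zero f g = refl
ΣFin-+ (suc k) f g rewrite ΣFin-+ k (λ a → f (F.suc a)) (λ a → g (F.suc a)) = +-middle-swap (f F.zero) (g F.zero) _ _

ΣFin-cong : ∀ k {f g : Fin k → ℕ} → (∀ a → f a ≡ g a) → ΣFin k f ≡ ΣFin k g
ΣFin-cong zero e = refl
ΣFin-cong (suc k) e = cong₂ _+_ (e F.zero) (ΣFin-cong k (λ a → e (F.suc a)))

ΣFin-0 : ∀ k → ΣFin k (λ _ → 0) ≡ 0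
ΣFin-0 zero = refl
ΣFin-0 (suc k) = ΣFin-0 k

ΣFin-*ˡ : ∀ k c (f : Fin k → ℕ) → ΣFin k (λ a → c * f a) ≡ c * ΣFin k f
ΣFin-*ˡ zero c f = sym (ℕP.*-zeroʳ c)
ΣFin-*ˡ (suc k) c f rewrite ΣFin-*ˡ k c (λ a → f (F.suc a)) = sym (ℕP.*-distribˡ-+ c (f F.zero) _)

sumL-ΣFin : ∀ k (F : Fin k → ℤ → ℕ) xs → sumL (λ x → ΣFin k (λ a → F a x)) xs ≡ ΣFin k (λ a → sumL (F a) xs)
sumL-ΣFin k F [] = sym (ΣFin-0 k)
sumL-ΣFin k F (x ∷ xs) rewrite sumL-ΣFin k F xs = sym (ΣFin-+ k (λ a → F a x) (λ a → sumL (F a) xs))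

ΣFin-last : ∀ k (f : Fin (suc k) → ℕ) → ΣFin (suc k) f ≡ ΣFin k (λ a → f (F.inject₁ a)) + f (F.fromℕ k)
ΣFin-last zero f = ℕP.+-comm (f F.zero) 0
ΣFin-last (suc k) f rewrite ΣFin-last k (λ a → f (F.suc a)) = sym (ℕP.+-assoc (f F.zero) _ _)

ΣFin-opp : ∀ k (f : Fin k → ℕ) → ΣFin k (λ a → f (F.opposite a)) ≡ ΣFin k f
ΣFin-opp zero f = refl
ΣFin-opp (suc k) f = trans (cong (λ z → f (F.fromℕ k) + z) (ΣFin-opp k (λ a → f (F.inject₁ a)))) (trans (ℕP.+-comm (f (F.fromℕ k)) _) (sym (ΣFin-last k f)))

ΣPairs : ∀ k → (Fin k → Fin k → ℕ) → ℕ
ΣPairs zero G = 0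
ΣPairs (suc k) G = ΣFin k (λ b → G F.zero (F.suc b)) + ΣPairs k (λ a b → G (F.suc a) (F.suc b))

ΣPairs-+ : ∀ k (G H : Fin k → Fin k → ℕ) → ΣPairs k (λ a b → G a b + H a b) ≡ ΣPairs k G + ΣPairs k H
ΣPairs-+ zero G H = refl
ΣPairs-+ (suc k) G H rewrite ΣPairs-+ k (λ a b → G (F.suc a) (F.suc b)) (λ a b → H (F.suc a) (F.suc b))
  | ΣFin-+ k (λ b → G F.zero (F.suc b)) (λ b → H F.zero (F.suc b)) =
  +-middle-swap (ΣFin k (λ b → G F.zero (F.suc b))) (ΣFin k (λ b → H F.zero (F.suc b))) (ΣPairs k (λ a b → G (F.suc a) (F.suc b))) (ΣPairs k (λ a b → H (F.suc a) (F.suc b)))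

ΣPairs-cong : ∀ k {G H : Fin k → Fin k → ℕ} → (∀ a b → G a b ≡ H a b) → ΣPairs k G ≡ ΣPairs k H
ΣPairs-cong zero e = refl
ΣPairs-cong (suc k) e = cong₂ _+_ (ΣFin-cong k (λ b → e F.zero (F.suc b))) (ΣPairs-cong k (λ a b → e (F.suc a) (F.suc b)))

ΣPairs-0 : ∀ k → ΣPairs k (λ _ _ → 0) ≡ 0
ΣPairs-0 zero = refl
ΣPairs-0 (suc k) rewrite ΣFin-0 k = ΣPairs-0 k

sumL-ΣPairs : ∀ k (G : Fin k → Fin k → ℤ → ℕ) xs → sumL (λ x → ΣPairs k (λ a b → G a b x)) xs ≡ ΣPairs k (λ a b → sumL (G a b) xs)
sumL-ΣPairs k G [] = sym (ΣPairs-0 k)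
sumL-ΣPairs k G (x ∷ xs) rewrite sumL-ΣPairs k G xs = sym (ΣPairs-+ k (λ a b → G a b x) (λ a b → sumL (G a b) xs))

ΣPairs-last : ∀ k (G : Fin (suc k) → Fin (suc k) → ℕ) →
  ΣPairs (suc k) G ≡ ΣPairs k (λ a b → G (F.inject₁ a) (F.inject₁ b)) + ΣFin k (λ a → G (F.inject₁ a) (F.fromℕ k))
ΣPairs-last zero G = refl
ΣPairs-last (suc k) G rewrite ΣFin-last k (λ b → G F.zero (F.suc b))
  | ΣPairs-last k (λ a b → G (F.suc a) (F.suc b)) =
  r (ΣFin k (λ a → G F.zero (F.suc (F.inject₁ a)))) (G F.zero (F.suc (F.fromℕ k)))
    (ΣPairs k (λ a b → G (F.suc (F.inject₁ a)) (F.suc (F.inject₁ b)))) (ΣFin k (λ a → G (F.suc (F.inject₁ a)) (F.suc (F.fromℕ k))))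
  where r : ∀ A a B C → A + a + (B + C) ≡ A + B + (a + C)
        r = NS.solve-∀

ΣPairs-opp : ∀ k (G : Fin k → Fin k → ℕ) → ΣPairs k (λ a b → G (F.opposite a) (F.opposite b)) ≡ ΣPairs k (λ a b → G b a)
ΣPairs-opp zero G = refl
ΣPairs-opp (suc k) G rewrite ΣFin-opp k (λ b → G (F.fromℕ k) (F.inject₁ b))
  | ΣPairs-opp k (λ a b → G (F.inject₁ a) (F.inject₁ b))
  | ΣPairs-last k (λ a b → G b a) = ℕP.+-comm (ΣFin k (λ b → G (F.fromℕ k) (F.inject₁ b))) (ΣPairs k (λ a b → G (F.inject₁ b) (F.inject₁ a)))

-- Rows with a forced configuration

==ᵛ-refl : ∀ {k} (v : Vec ℕ k) → (v ==ᵛ v) ≡ true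
==ᵛ-refl [] = refl
==ᵛ-refl (a ∷ v) with a ℕ.≟ a
... | yes _ = ==ᵛ-refl v
... | no ne = ⊥-elim (ne refl)

==ᵛ-false : ∀ {k} (u v : Vec ℕ k) → u ≢ v → (u ==ᵛ v) ≡ false
==ᵛ-false [] [] ne = ⊥-elim (ne refl)
==ᵛ-false (a ∷ u) (b ∷ v) ne with a ℕ.≟ b
... | no _ = refl
... | yes refl = ==ᵛ-false u v (λ e → ne (cong (a ∷_) e))

zip+-cancel : ∀ {k} (K L L' : Vec ℕ k) → V.zipWith _+_ K L ≡ V.zipWith _+_ K L' → L ≡ L'
zip+-cancel [] [] [] e = refl
zip+-cancel (c ∷ K) (x ∷ L) (y ∷ L') e =
  cong₂ _∷_ (ℕP.+-cancelˡ-≡ c x y (cong V.head e)) (zip+-cancel K L L' (cong V.tail e))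

IsBinary : ∀ {k} → Vec ℕ k → Set
IsBinary [] = ⊤
IsBinary (a ∷ v) = (a ≤ 1) × IsBinary v

concatMap-concatMap : ∀ {A B C : Set} (f : B → List C) (g : A → List B) xs →
  concatMap f (concatMap g xs) ≡ concatMap (λ x → concatMap f (g x)) xs
concatMap-concatMap f g [] = refl
concatMap-concatMap f g (x ∷ xs) rewrite LP.concatMap-++ f (g x) (concatMap g xs) | concatMap-concatMap f g xs = refl

concatMap-allLabels-unique : ∀ k (f : Label k → Poly) (L0 : Label k) → IsBinary L0 → (∀ L → L ≢ L0 → f L ≡ []) →
  concatMap f (allLabels k) ≡ f L0
concatMap-allLabels-unique zero f [] _ _ = LP.++-identityʳ (f [])
concatMap-allLabels-unique (suc k) f (b ∷ v0) (b≤1 , bin) h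
  rewrite concatMap-concatMap f (λ v → (0 ∷ v) ∷ (1 ∷ v) ∷ []) (allLabels k) =
  trans (concatMap-allLabels-unique k f' v0 bin h') (fin b b≤1 h)
  where
  f' : Label k → Poly
  f' v = f (0 ∷ v) ++ (f (1 ∷ v) ++ [])
  h' : ∀ L → L ≢ v0 → f' L ≡ []
  h' L ne rewrite h (0 ∷ L) (λ e → ne (cong V.tail e)) | h (1 ∷ L) (λ e → ne (cong V.tail e)) = refl
  fin : ∀ b → b ≤ 1 → (∀ L → L ≢ b ∷ v0 → f L ≡ []) → f' v0 ≡ f (b ∷ v0)
  fin zero _ h rewrite h (1 ∷ v0) (λ ()) = LP.++-identityʳ _
  fin (suc zero) _ h rewrite h (0 ∷ v0) (λ ()) = LP.++-identityʳ _
  fin (suc (suc _)) (s≤s ()) h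

foldMono : (ℤ → Mono) → List ℤ → Mono
foldMono m [] = (0 , + 0)
foldMono m (x ∷ xs) = m x *ᵐ foldMono m xs

-- B x and T x are the bottom and top labels of column x, H x the label of the
-- horizontal edge to its right, and m x the weight of the vertex at column x.
module ForcedRow {k} (w : VertexWeight k) (B T H : ℤ → Label k) (m : ℤ → Mono) where

  Forced : ℤ → Set
  Forced x = IsBinary (H x) × (w (B x) (H (x - + 1)) (T x) (H x) ≡ just (m x))
           × (∀ L → L ≢ H x → w (B x) (H (x - + 1)) (T x) L ≡ nothing)

  column : ℤ → Label k × Label k
  column x = B x , T x

  mutual
    rowPF-forced : ∀ s n (J : Label k) → J ≡ H (s - + 1) → (∀ x → InRange s n x → Forced x) →
      H (s ℤ.+ + n - + 1) ≡ emptyLabel k →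
      rowPF w J (List.map column (intRange s n)) ≡ foldMono m (intRange s n) ∷ []
    rowPF-forced s zero J refl _ end rewrite cong H (cong (_- + 1) (ℤP.+-identityʳ s)) | end
      | ==ᵛ-refl (emptyLabel k) = refl
    rowPF-forced s (suc n) J refl forced end with forced s (InRange-head s n)
    ... | binary , w≡just , w≡nothing =
      trans (concatMap-allLabels-unique k _ (H s) binary (λ L L≢ → step-nothing s n L (w≡nothing L L≢)))
            (step-just s n w≡just (rowPF-forced-tail s n forced end))

    rowPF-forced-tail : ∀ s n → (∀ x → InRange s (suc n) x → Forced x) → H (s ℤ.+ + suc n - + 1) ≡ emptyLabel k →
      rowPF w (H s) (List.map column (intRange (s ℤ.+ + 1) n)) ≡ foldMono m (intRange (s ℤ.+ + 1) n) ∷ []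
    rowPF-forced-tail s n forced end =
      rowPF-forced (s ℤ.+ + 1) n (H s) (cong H (sym (ring₁ s))) (λ x x∈ → forced x (InRange-tail s n x x∈))
        (trans (cong H (ring₂ s (+ n))) end)
      where ring₁ : ∀ s → s ℤ.+ + 1 - + 1 ≡ s
            ring₁ = solve-∀
            ring₂ : ∀ s n → s ℤ.+ + 1 ℤ.+ n - + 1 ≡ s ℤ.+ (+ 1 ℤ.+ n) - + 1
            ring₂ = solve-∀

    -- The underscores are solved from the uses above; the otherwise unused n
    -- keeps the rest of the row in scope of those solutions.
    step-nothing : ∀ s (n : ℕ) L → w (B s) (H (s - + 1)) (T s) L ≡ nothing → _ ≡ []
    step-nothing s n L w≡nothing rewrite w≡nothing = refl

    step-just : ∀ s n → w (B s) (H (s - + 1)) (T s) (H s) ≡ just (m s) →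
      rowPF w (H s) (List.map column (intRange (s ℤ.+ + 1) n)) ≡ foldMono m (intRange (s ℤ.+ + 1) n) ∷ [] →
      _ ≡ (m s *ᵐ foldMono m (intRange (s ℤ.+ + 1) n)) ∷ []
    step-just s n w≡just rest rewrite w≡just | rest = refl

zipWith-tabulate : ∀ {k} (op : ℕ → ℕ → ℕ) (f g : Fin k → ℕ) → V.zipWith op (tabulate f) (tabulate g) ≡ tabulate (λ a → op (f a) (g a))
zipWith-tabulate {zero} op f g = refl
zipWith-tabulate {suc k} op f g = cong (op (f F.zero) (g F.zero) ∷_) (zipWith-tabulate op (λ a → f (F.suc a)) (λ a → g (F.suc a)))

tabulate-zero : ∀ k → tabulate {n = k} (λ _ → 0) ≡ emptyLabel k
tabulate-zero zero = refl
tabulate-zero (suc k) = cong (0 ∷_) (tabulate-zero k)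

allᵛ-tabulate : ∀ {k} (p : ℕ → ℕ → Bool) (f g : Fin k → ℕ) → (∀ a → p (f a) (g a) ≡ true) → allᵛ p (tabulate f) (tabulate g) ≡ true
allᵛ-tabulate {zero} p f g h = refl
allᵛ-tabulate {suc k} p f g h rewrite h F.zero = allᵛ-tabulate p (λ a → f (F.suc a)) (λ a → g (F.suc a)) (λ a → h (F.suc a))

size-tabulate : ∀ {k} (f : Fin k → ℕ) → size (tabulate f) ≡ ΣFin k f
size-tabulate {zero} f = refl
size-tabulate {suc k} f = cong (λ z → f F.zero + z) (size-tabulate (λ a → f (F.suc a)))

φ-tabulate : ∀ {k} (f g : Fin k → ℕ) → φ (tabulate f) (tabulate g) ≡ ΣPairs k (λ a b → f a * g b)
φ-tabulate {zero} f g = refl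
φ-tabulate {suc k} f g = cong₂ _+_ (trans (cong (λ z → f F.zero * z) (size-tabulate (λ a → g (F.suc a)))) (sym (ΣFin-*ˡ k (f F.zero) (λ b → g (F.suc b)))))
  (φ-tabulate (λ a → f (F.suc a)) (λ a → g (F.suc a)))

IsBinary-tabulate : ∀ {k} (f : Fin k → ℕ) → (∀ a → f a ≤ 1) → IsBinary (tabulate f)
IsBinary-tabulate {zero} f h = _
IsBinary-tabulate {suc k} f h = h F.zero , IsBinary-tabulate (λ a → f (F.suc a)) (λ a → h (F.suc a))

bit-if : ∀ b → (if b then 1 else 0) ≡ bit b
bit-if true = refl
bit-if false = refl

boundaryLabel-tabulate : ∀ {k} (ρ : Tuple k) L c → boundaryLabel ρ L c ≡ tabulate (λ a → bit (occupied (ρ a) L c))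
boundaryLabel-tabulate ρ L c = VP.tabulate-cong (λ a → bit-if (occupied (ρ a) L c))

white-just : ∀ {k} (I J K L : Label k) → V.zipWith _+_ I J ≡ V.zipWith _+_ K L →
  allᵛ (λ i j → not ⌊ i + j ℕ.≟ 2 ⌋) I J ≡ true →
  white I J K L ≡ just (size L , + φ L (V.zipWith _+_ I J))
white-just I J K L e h rewrite sym e | ==ᵛ-refl (V.zipWith _+_ I J) | h = refl

white-nothing : ∀ {k} (I J K L L0 : Label k) → V.zipWith _+_ I J ≡ V.zipWith _+_ K L0 → L ≢ L0 → white I J K L ≡ nothing
white-nothing I J K L L0 e ne rewrite ==ᵛ-false (V.zipWith _+_ I J) (V.zipWith _+_ K L)
  (λ e' → ne (zip+-cancel K L L0 (trans (sym e') e))) = refl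

purple-just : ∀ {k} (I J K L : Label k) → V.zipWith _+_ I J ≡ V.zipWith _+_ K L →
  allᵛ (λ kc jc → ⌊ jc ℕ.≤? kc ⌋) K J ≡ true →
  purple I J K L ≡ just (size L , + φ L (V.zipWith _∸_ K J))
purple-just I J K L e h rewrite sym e | ==ᵛ-refl (V.zipWith _+_ I J) | h = refl

purple-nothing : ∀ {k} (I J K L L0 : Label k) → V.zipWith _+_ I J ≡ V.zipWith _+_ K L0 → L ≢ L0 → purple I J K L ≡ nothing
purple-nothing I J K L L0 e ne rewrite ==ᵛ-false (V.zipWith _+_ I J) (V.zipWith _+_ K L)
  (λ e' → ne (zip+-cancel K L L0 (trans (sym e') e))) = refl

foldMono-sum : ∀ (m : ℤ → Mono) (X Y : ℤ → ℕ) → (∀ x → m x ≡ (X x , + Y x)) → ∀ xs →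
  foldMono m xs ≡ (sumL X xs , + sumL Y xs)
foldMono-sum m X Y h [] = refl
foldMono-sum m X Y h (x ∷ xs) rewrite h x | foldMono-sum m X Y h xs = refl

-- Particle sites of partitions

site : ∀ {ℓ} → Vec ℕ ℓ → ℕ → ℤ
site v j = + part v j - + j

[+p]-[+j]-mono-≤ : ∀ {p p' j j'} → p' ≤ p → j ≤ j' → + p' - + j' ℤ.≤ + p - + j
[+p]-[+j]-mono-≤ a b = ℤP.+-mono-≤ (ℤ.+≤+ a) (ℤP.neg-mono-≤ (ℤ.+≤+ b))

[+p]-[+j]-mono-< : ∀ {p p' j j'} → p' ≤ p → j < j' → + p' - + j' ℤ.< + p - + j
[+p]-[+j]-mono-< a b = ℤP.+-mono-≤-< (ℤ.+≤+ a) (ℤP.neg-mono-< (ℤ.+<+ b))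

part-beyond : ∀ {ℓ} (v : Vec ℕ ℓ) j → ℓ < j → part v j ≡ 0
part-beyond [] j _ = refl
part-beyond (x ∷ v) (suc (suc j)) (s≤s h) = part-beyond v (suc j) h

part-bound : ∀ {ℓ} (v : Vec ℕ ℓ) B → (∀ i → lookup v i ≤ B) → ∀ j → part v j ≤ B
part-bound [] B h j = z≤n
part-bound (x ∷ v) B h zero = z≤n
part-bound (x ∷ v) B h (suc zero) = h F.zero
part-bound (x ∷ v) B h (suc (suc j)) = part-bound v B (λ i → h (F.suc i)) (suc j)

part-antitone-+ : ∀ {ℓ} (v : Vec ℕ ℓ) → IsPartition v → ∀ j d → part v (suc j + d) ≤ part v (suc j)
part-antitone-+ v P j zero rewrite ℕP.+-identityʳ j = ℕP.≤-refl
part-antitone-+ v P j (suc d) rewrite ℕP.+-suc j d = ℕP.≤-trans (P (j + d)) (part-antitone-+ v P j d)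

part-antitone : ∀ {ℓ} (v : Vec ℕ ℓ) → IsPartition v → ∀ {j j'} → 1 ≤ j → j ≤ j' → part v j' ≤ part v j
part-antitone v P {suc j} {j'} _ h with ℕP.m≤n⇒∃[o]m+o≡n h
... | d , refl = part-antitone-+ v P j d

site-strict : ∀ {ℓ} (v : Vec ℕ ℓ) → IsPartition v → ∀ {j j'} → 1 ≤ j → j < j' → site v j' ℤ.< site v j
site-strict v P h1 h2 = [+p]-[+j]-mono-< (part-antitone v P h1 (ℕP.<⇒≤ h2)) h2

site≥-ℓ : ∀ {ℓ} (v : Vec ℕ ℓ) j → j ≤ ℓ → ℤ.- + ℓ ℤ.≤ site v j
site≥-ℓ {ℓ} v j h = subst₂ ℤ._≤_ (ℤP.+-identityˡ (ℤ.- + ℓ)) refl ([+p]-[+j]-mono-≤ {p = part v j} {p' = 0} z≤n h)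

point≡bit-≟ : ∀ p x → point p x ≡ bit ⌊ x ℤ.≟ p ⌋
point≡bit-≟ p x with x ℤ.≟ p
... | yes refl = χ-inside ℤP.≤-refl (proj₂ (InRange-head p 0))
... | no ne with position? p (p ℤ.+ + 1) x
...   | below a = χ-below {p} {p ℤ.+ + 1} a
...   | above _ b = χ-above {p} {p ℤ.+ + 1} b
...   | inside a b = ⊥-elim (ne (ℤP.≤-antisym (<+1⇒≤ b) a))

⌊no⌋∨b≡b : ∀ {P : Set} (d : Dec P) → ¬ P → ∀ b → ⌊ d ⌋ ∨ b ≡ b
⌊no⌋∨b≡b (yes p) np b = ⊥-elim (np p)
⌊no⌋∨b≡b (no _) np b = refl

bit-∨ : ∀ {P : Set} (d : Dec P) b → (P → b ≡ false) → bit (⌊ d ⌋ ∨ b) ≡ bit ⌊ d ⌋ + bit b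
bit-∨ (yes p) b h rewrite h p = refl
bit-∨ (no _) b h = refl

occupied-false : ∀ (ρ : ℕ → ℕ) n x → (∀ j → 1 ≤ j → j ≤ n → x ≢ + ρ j - + j) → occupied ρ n x ≡ false
occupied-false ρ zero x h = refl
occupied-false ρ (suc n) x h = trans (⌊no⌋∨b≡b (x ℤ.≟ (+ ρ (suc n) - + suc n)) (h (suc n) (s≤s z≤n) ℕP.≤-refl) (occupied ρ n x))
  (occupied-false ρ n x (λ j a b → h j a (ℕP.m≤n⇒m≤1+n b)))

bit-occupied : ∀ {ℓ} (v : Vec ℕ ℓ) → IsPartition v → ∀ n x →
  bit (occupied (part v) n x) ≡ sumN n (λ j → point (site v j) x)
bit-occupied v P zero x = refl
bit-occupied v P (suc n) x = trans (bit-∨ (x ℤ.≟ site v (suc n)) (occupied (part v) n x)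
     (λ e → occupied-false (part v) n x (λ j a b e' → ℤP.<-irrefl (trans (sym e) e') (site-strict v P a (s≤s b)))))
  (cong₂ _+_ (sym (point≡bit-≟ (site v (suc n)) x)) (bit-occupied v P n x))

neg≤ : ∀ {m n} → m ≤ n → ℤ.- + n ℤ.≤ ℤ.- + m
neg≤ h = ℤP.neg-mono-≤ (ℤ.+≤+ h)

sumN-point-padding : ∀ {ℓ} (v : Vec ℕ ℓ) x d →
  sumN (d + ℓ) (λ j → point (site v j) x) ≡ sumN ℓ (λ j → point (site v j) x) + χ (ℤ.- + (d + ℓ)) (ℤ.- + ℓ) x
sumN-point-padding {ℓ} v x zero = sym (trans (cong (λ z → sumN ℓ (λ j → point (site v j) x) + z) (χ-empty (ℤ.- + ℓ) x)) (ℕP.+-identityʳ _))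
sumN-point-padding {ℓ} v x (suc d) rewrite sumN-point-padding v x d | part-beyond v (suc (d + ℓ)) (s≤s (ℕP.m≤n+m ℓ d)) =
  begin
    point q x + (S + χ (ℤ.- + (d + ℓ)) (ℤ.- + ℓ) x)
      ≡⟨ left-swap (point q x) S _ ⟩
    S + (χ q (q ℤ.+ + 1) x + χ (ℤ.- + (d + ℓ)) (ℤ.- + ℓ) x)
      ≡⟨ cong (λ z → S + (χ q z x + χ (ℤ.- + (d + ℓ)) (ℤ.- + ℓ) x)) (ring (+ (d + ℓ))) ⟩
    S + (χ q (ℤ.- + (d + ℓ)) x + χ (ℤ.- + (d + ℓ)) (ℤ.- + ℓ) x)
      ≡⟨ cong (λ z → S + z) (χ-concat q≤ (neg≤ (ℕP.m≤n+m ℓ d)) x) ⟩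
    S + χ q (ℤ.- + ℓ) x
      ≡⟨ cong (λ z → S + χ z (ℤ.- + ℓ) x) (ℤP.+-identityˡ (ℤ.- + suc (d + ℓ))) ⟩
    S + χ (ℤ.- + suc (d + ℓ)) (ℤ.- + ℓ) x ∎
  where
  open ≡-Reasoning
  q : ℤ
  q = + 0 - + suc (d + ℓ)
  S : ℕ
  S = sumN ℓ (λ j → point (site v j) x)
  left-swap : ∀ a b c → a + (b + c) ≡ b + (a + c)
  left-swap = NS.solve-∀
  ring : ∀ m → + 0 - (+ 1 ℤ.+ m) ℤ.+ + 1 ≡ ℤ.- m
  ring = solve-∀
  q≤ : q ℤ.≤ ℤ.- + (d + ℓ)
  q≤ = subst₂ ℤ._≤_ (sym (ℤP.+-identityˡ _)) refl (neg≤ (ℕP.n≤1+n (d + ℓ)))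

bit-occupied-padded : ∀ {ℓ} (v : Vec ℕ ℓ) → IsPartition v → ∀ L₁ → ℓ ≤ L₁ → ∀ x →
  bit (occupied (part v) L₁ x) ≡ sumN ℓ (λ j → point (site v j) x) + χ (ℤ.- + L₁) (ℤ.- + ℓ) x
bit-occupied-padded {ℓ} v P L₁ h x with ℕP.m≤n⇒∃[o]m+o≡n h
... | d , refl rewrite ℕP.+-comm ℓ d = trans (bit-occupied v P (d + ℓ) x) (sumN-point-padding v x d)

record Interlaced (P Q : ℕ → ℤ) (n : ℕ) : Set where
  field
    nonempty : ∀ j → 1 ≤ j → j ≤ n → P j ℤ.≤ Q j
    ordered  : ∀ j → 1 ≤ j → suc j ≤ n → Q (suc j) ℤ.≤ P j

module _ {P Q : ℕ → ℤ} where
  open Interlaced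

  Interlaced-init : ∀ {n} → Interlaced P Q (suc n) → Interlaced P Q n
  Interlaced-init I = record
    { nonempty = λ j j≥1 j≤n → nonempty I j j≥1 (ℕP.m≤n⇒m≤1+n j≤n)
    ; ordered  = λ j j≥1 j<n → ordered I j j≥1 (ℕP.m≤n⇒m≤1+n j<n) }

  Interlaced-antitone : ∀ {n} → Interlaced P Q n → ∀ j → 1 ≤ j → j ≤ n → P n ℤ.≤ P j
  Interlaced-antitone {zero} I (suc _) _ ()
  Interlaced-antitone {suc n} I j j≥1 j≤1+n with ℕP.m≤n⇒m<n∨m≡n j≤1+n
  ... | inj₂ refl = ℤP.≤-refl
  ... | inj₁ (s≤s j≤n) = begin
    P (suc n) ≤⟨ nonempty I (suc n) (s≤s z≤n) ℕP.≤-refl ⟩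
    Q (suc n) ≤⟨ ordered I n (ℕP.≤-trans j≥1 j≤n) ℕP.≤-refl ⟩
    P n       ≤⟨ Interlaced-antitone (Interlaced-init I) j j≥1 j≤n ⟩
    P j       ∎
    where open ℤP.≤-Reasoning

  Interlaced-left-of-last : ∀ {n} → Interlaced P Q (suc n) →
    ∀ {x} → x ℤ.< Q (suc n) → ∀ j → 1 ≤ j → j ≤ n → x ℤ.< P j
  Interlaced-left-of-last {n} I {x} x<Q j j≥1 j≤n = begin-strict
    x         <⟨ x<Q ⟩
    Q (suc n) ≤⟨ ordered I n (ℕP.≤-trans j≥1 j≤n) ℕP.≤-refl ⟩
    P n       ≤⟨ Interlaced-antitone (Interlaced-init I) j j≥1 j≤n ⟩
    P j       ∎
    where open ℤP.≤-Reasoning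

  Interlaced-sumN-χ≤1 : ∀ {n} → Interlaced P Q n → ∀ x → sumN n (λ j → χ (P j) (Q j) x) ≤ 1
  Interlaced-sumN-χ≤1 {zero} I x = z≤n
  Interlaced-sumN-χ≤1 {suc n} I x with position? (P (suc n)) (Q (suc n)) x
  ... | below x<P rewrite χ-below {P (suc n)} {Q (suc n)} x<P = Interlaced-sumN-χ≤1 (Interlaced-init I) x
  ... | above _ Q≤x rewrite χ-above {P (suc n)} {Q (suc n)} Q≤x = Interlaced-sumN-χ≤1 (Interlaced-init I) x
  ... | inside P≤x x<Q rewrite χ-inside P≤x x<Q
    | sumN-0 n (λ j j≥1 j≤n → χ-below {P j} {Q j} (Interlaced-left-of-last I x<Q j j≥1 j≤n)) = s≤s z≤n

module Strip {ℓ} (lv mv : Vec ℕ ℓ) (HS : HorizontalStrip lv mv) where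

  a b : ℕ → ℤ
  a j = site mv j
  b j = site lv j

  a≤b : ∀ j → 1 ≤ j → a j ℤ.≤ b j
  a≤b (suc j) _ = [+p]-[+j]-mono-≤ {j = suc j} (proj₁ (HS j)) ℕP.≤-refl

  b<a : ∀ j → 1 ≤ j → b (suc j) ℤ.< a j
  b<a (suc j) _ = [+p]-[+j]-mono-< {j = suc j} (proj₂ (HS j)) ℕP.≤-refl

  sites-disjoint : ∀ x → sumN ℓ (λ j → χ (a j) (b j ℤ.+ + 1) x) ≤ 1
  sites-disjoint = Interlaced-sumN-χ≤1 {P = a} {Q = λ j → b j ℤ.+ + 1} {n = ℓ} (record
    { nonempty = λ j j≥1 _ → ℤP.≤-trans (a≤b j j≥1) (ℤP.i≤i+j (b j) (+ 1))
    ; ordered  = λ j j≥1 _ → <⇒+1≤ (b<a j j≥1) })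

-- The white row

-- One colour of the white row: its path leaves column x to the right iff
-- a j ≤ x < b j for some j.  Columns −L₁ … −ℓ−1 hold the zero parts beyond ℓ
-- on both boundaries; that is the padding.
module WhiteColour {ℓ} (lv mv : Vec ℕ ℓ) (Pl : IsPartition lv) (Pm : IsPartition mv)
    (HS : HorizontalStrip lv mv) (L₁ : ℕ) (ℓ≤L₁ : ℓ ≤ L₁) where

  open Strip lv mv HS public

  path : ℤ → ℕ
  path x = sumN ℓ (λ j → χ (a j) (b j) x)

  padding : ℤ → ℕ
  padding x = χ (ℤ.- + L₁) (ℤ.- + ℓ) x

  flow : ℤ → ℕ
  flow x = sumN ℓ (λ j → χ (a j) (b j ℤ.+ + 1) x) + padding x

  bottom-occupied : ∀ x → bit (occupied (part mv) L₁ x) ≡ sumN ℓ (λ j → point (a j) x) + padding x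
  bottom-occupied x = bit-occupied-padded mv Pm L₁ ℓ≤L₁ x

  top-occupied : ∀ x → bit (occupied (part lv) L₁ x) ≡ sumN ℓ (λ j → point (b j) x) + padding x
  top-occupied x = bit-occupied-padded lv Pl L₁ ℓ≤L₁ x

  enter : ∀ j → 1 ≤ j → ∀ x → point (a j) x + χ (a j) (b j) (x - + 1) ≡ χ (a j) (b j ℤ.+ + 1) x
  enter j j≥1 x = trans (cong (λ z → point (a j) x + z) (χ-shift (a j) (b j) x))
    (χ-concat (ℤP.i≤i+j (a j) (+ 1)) (ℤP.+-monoˡ-≤ (+ 1) (a≤b j j≥1)) x)

  leave : ∀ j → 1 ≤ j → ∀ x → point (b j) x + χ (a j) (b j) x ≡ χ (a j) (b j ℤ.+ + 1) x
  leave j j≥1 x = trans (ℕP.+-comm (point (b j) x) _) (χ-concat (a≤b j j≥1) (ℤP.i≤i+j (b j) (+ 1)) x)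

  flow-bottom : ∀ x → bit (occupied (part mv) L₁ x) + path (x - + 1) ≡ flow x
  flow-bottom x rewrite bottom-occupied x = begin
    sumN ℓ (λ j → point (a j) x) + padding x + path (x - + 1)
      ≡⟨ +-right-swap (sumN ℓ (λ j → point (a j) x)) (padding x) (path (x - + 1)) ⟩
    sumN ℓ (λ j → point (a j) x) + path (x - + 1) + padding x
      ≡⟨ cong (_+ padding x) (trans (sym (sumN-+ ℓ (λ j → point (a j) x) (λ j → χ (a j) (b j) (x - + 1))))
           (sumN-cong ℓ (λ j j≥1 _ → enter j j≥1 x))) ⟩
    flow x ∎
    where open ≡-Reasoning

  flow-top : ∀ x → bit (occupied (part lv) L₁ x) + path x ≡ flow x
  flow-top x rewrite top-occupied x = begin
    sumN ℓ (λ j → point (b j) x) + padding x + path x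
      ≡⟨ +-right-swap (sumN ℓ (λ j → point (b j) x)) (padding x) (path x) ⟩
    sumN ℓ (λ j → point (b j) x) + path x + padding x
      ≡⟨ cong (_+ padding x) (trans (sym (sumN-+ ℓ (λ j → point (b j) x) (λ j → χ (a j) (b j) x)))
           (sumN-cong ℓ (λ j j≥1 _ → leave j j≥1 x))) ⟩
    flow x ∎
    where open ≡-Reasoning

  flow≤1 : ∀ x → flow x ≤ 1
  flow≤1 x with position? (ℤ.- + L₁) (ℤ.- + ℓ) x
  ... | below h rewrite χ-below {ℤ.- + L₁} {ℤ.- + ℓ} h | ℕP.+-identityʳ (sumN ℓ (λ j → χ (a j) (b j ℤ.+ + 1) x)) = sites-disjoint x
  ... | above _ h rewrite χ-above {ℤ.- + L₁} {ℤ.- + ℓ} h | ℕP.+-identityʳ (sumN ℓ (λ j → χ (a j) (b j ℤ.+ + 1) x)) = sites-disjoint x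
  ... | inside h1 h2 rewrite χ-inside h1 h2 | sumN-0 ℓ (λ j c1 c2 → χ-below {a j} {b j ℤ.+ + 1} (ℤP.<-≤-trans h2 (site≥-ℓ mv j c2))) = s≤s z≤n

  path≤1 : ∀ x → path x ≤ 1
  path≤1 x = ℕP.≤-trans (ℕP.m≤n+m (path x) _) (ℕP.≤-trans (ℕP.≤-reflexive (flow-top x)) (flow≤1 x))

not-two : ∀ i j → i + j ≤ 1 → not ⌊ i + j ℕ.≟ 2 ⌋ ≡ true
not-two i j i+j≤1 with i + j ℕ.≟ 2
... | no _ = refl
... | yes i+j≡2 with subst (_≤ 1) i+j≡2 i+j≤1
...   | s≤s ()

i-1<i : ∀ x → x - + 1 ℤ.< x
i-1<i x = +1≤⇒< (ℤP.≤-reflexive (e x))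
  where e : ∀ x → x - + 1 ℤ.+ + 1 ≡ x
        e = solve-∀

lastColumn : ∀ L N → ℤ.- + L ℤ.+ + (L + N + 1) - + 1 ≡ + N
lastColumn L N rewrite ℤP.pos-+ (L + N) 1 | ℤP.pos-+ L N = e (+ L) (+ N)
  where e : ∀ l n → ℤ.- l ℤ.+ (l ℤ.+ n ℤ.+ + 1) - + 1 ≡ n
        e = solve-∀

site≤N : ∀ {ℓ} (v : Vec ℕ ℓ) N → (∀ i → lookup v i ≤ N) → ∀ j → site v j ℤ.≤ + N
site≤N v N h j = subst₂ ℤ._≤_ refl (ℤP.+-identityʳ (+ N)) ([+p]-[+j]-mono-≤ {p = N} {p' = part v j} {j = 0} {j' = j} (part-bound v N h j) z≤n)

module WhiteRow {k ℓ} (lam mu : Fin k → Vec ℕ ℓ) (Pl : ∀ a → IsPartition (lam a)) (Pm : ∀ a → IsPartition (mu a))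
    (HS : ∀ a → HorizontalStrip (lam a) (mu a)) (L₁ N₁ : ℕ) (ℓ≤L₁ : ℓ ≤ L₁) (λ≤N₁ : ∀ a i → lookup (lam a) i ≤ N₁) where

  module C (a : Fin k) = WhiteColour (lam a) (mu a) (Pl a) (Pm a) (HS a) L₁ ℓ≤L₁

  path : Fin k → ℤ → ℕ
  path a x = C.path a x

  flow : Fin k → ℤ → ℕ
  flow a x = C.flow a x

  B T H : ℤ → Label k
  B x = boundaryLabel (asTuple mu) L₁ x
  T x = boundaryLabel (asTuple lam) L₁ x
  H x = tabulate (λ a → path a x)

  xExponent tExponent : ℤ → ℕ
  xExponent x = ΣFin k (λ a → path a x)
  tExponent x = ΣPairs k (λ a b → path a x * flow b x)

  weight : ℤ → Mono
  weight x = (xExponent x , + tExponent x)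

  bottom+left : ∀ x → V.zipWith _+_ (B x) (H (x - + 1)) ≡ tabulate (λ a → flow a x)
  bottom+left x rewrite boundaryLabel-tabulate (asTuple mu) L₁ x = trans (zipWith-tabulate _+_ _ _) (VP.tabulate-cong (λ a → C.flow-bottom a x))

  top+right : ∀ x → V.zipWith _+_ (T x) (H x) ≡ tabulate (λ a → flow a x)
  top+right x rewrite boundaryLabel-tabulate (asTuple lam) L₁ x = trans (zipWith-tabulate _+_ _ _) (VP.tabulate-cong (λ a → C.flow-top a x))

  no-double-occupancy : ∀ x → allᵛ (λ i j → not ⌊ i + j ℕ.≟ 2 ⌋) (B x) (H (x - + 1)) ≡ true
  no-double-occupancy x rewrite boundaryLabel-tabulate (asTuple mu) L₁ x = allᵛ-tabulate _ _ _
    (λ a → not-two (bit (occupied (part (mu a)) L₁ x)) (path a (x - + 1)) (ℕP.≤-trans (ℕP.≤-reflexive (C.flow-bottom a x)) (C.flow≤1 a x)))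

  forced : ∀ x → ForcedRow.Forced white B T H weight x
  forced x = IsBinary-tabulate _ (λ a → C.path≤1 a x) ,
    trans (white-just (B x) (H (x - + 1)) (T x) (H x) (trans (bottom+left x) (sym (top+right x))) (no-double-occupancy x))
      (cong just (cong₂ _,_ (size-tabulate (λ a → path a x))
        (cong +_ (trans (cong (φ (H x)) (bottom+left x)) (φ-tabulate (λ a → path a x) (λ a → flow a x)))))) ,
    (λ L ne → white-nothing (B x) (H (x - + 1)) (T x) L (H x) (trans (bottom+left x) (sym (top+right x))) ne)

  cols : List ℤ
  cols = columns L₁ N₁

  left-boundary : emptyLabel k ≡ H (ℤ.- + L₁ - + 1)
  left-boundary = trans (sym (tabulate-zero k)) (VP.tabulate-cong (λ a → sym (sumN-0 ℓ (λ j h1 h2 →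
    χ-below {C.a a j} (ℤP.<-≤-trans (ℤP.<-≤-trans (i-1<i (ℤ.- + L₁)) (neg≤ ℓ≤L₁)) (site≥-ℓ (mu a) j h2))))))

  right-boundary : H (ℤ.- + L₁ ℤ.+ + (L₁ + N₁ + 1) - + 1) ≡ emptyLabel k
  right-boundary rewrite lastColumn L₁ N₁ = trans (VP.tabulate-cong (λ a → sumN-0 ℓ (λ j h1 h2 → χ-above {C.a a j} {C.b a j}
    (site≤N (lam a) N₁ (λ≤N₁ a) j)))) (tabulate-zero k)

  white-row : 𝓛 (asTuple lam) (asTuple mu) L₁ N₁ ≡ (sumL xExponent cols , + sumL tExponent cols) ∷ []
  white-row = trans (ForcedRow.rowPF-forced white B T H weight (ℤ.- + L₁) (L₁ + N₁ + 1) (emptyLabel k) left-boundary (λ x _ → forced x) right-boundary)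
    (cong (_∷ []) (foldMono-sum weight xExponent tExponent (λ x → refl) cols))

-- Conjugate partitions

conj-no : ∀ {ℓ} x (v : Vec ℕ ℓ) j → ¬ j ≤ x → conj (x ∷ v) j ≡ conj v j
conj-no x v j h with j ℕ.≤ᵇ x in eq
... | true = ⊥-elim (h (ℕP.≤ᵇ⇒≤ j x (subst Tᵇ (sym eq) tt)))
... | false = refl

conj-≤ : ∀ {ℓ} (v : Vec ℕ ℓ) j → conj v j ≤ ℓ
conj-≤ [] j = z≤n
conj-≤ (x ∷ v) j with j ℕ.≤ᵇ x
... | true = s≤s (conj-≤ v j)
... | false = ℕP.m≤n⇒m≤1+n (conj-≤ v j)

IsPartition-tail : ∀ {ℓ} x (v : Vec ℕ ℓ) → IsPartition (x ∷ v) → IsPartition v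
IsPartition-tail x v P j = P (suc j)

conj-zero : ∀ {ℓ} (v : Vec ℕ ℓ) j → (∀ i → 1 ≤ i → part v i < j) → conj v j ≡ 0
conj-zero [] j h = refl
conj-zero (x ∷ v) j h = trans (conj-no x v j (ℕP.<⇒≱ (h 1 (s≤s z≤n))))
  (conj-zero v j (λ { (suc i) _ → h (suc (suc i)) (s≤s z≤n) }))

conj-char : ∀ {ℓ} (v : Vec ℕ ℓ) → IsPartition v → ∀ j → 1 ≤ j →
  (∀ i → 1 ≤ i → i ≤ conj v j → j ≤ part v i) × (∀ i → conj v j < i → part v i < j)
conj-char [] P j hj = (λ { (suc i) h1 () }) , (λ i _ → hj)
conj-char (x ∷ v) P j hj with j ℕ.≤ᵇ x in eq
... | true = f1 , f2
  where
  ih = conj-char v (IsPartition-tail x v P) j hj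
  f1 : ∀ i → 1 ≤ i → i ≤ suc (conj v j) → j ≤ part (x ∷ v) i
  jx : j ≤ x
  jx = ℕP.≤ᵇ⇒≤ j x (subst Tᵇ (sym eq) tt)
  f1 (suc zero) _ _ = jx
  f1 (suc (suc i)) _ (s≤s h) = proj₁ ih (suc i) (s≤s z≤n) h
  f2 : ∀ i → suc (conj v j) < i → part (x ∷ v) i < j
  f2 (suc (suc i)) (s≤s h) = proj₂ ih (suc i) h
... | false = f1 , f2
  where
  jx : ¬ j ≤ x
  jx h = subst Tᵇ eq (ℕP.≤⇒≤ᵇ h)
  lt : ∀ i → 1 ≤ i → part (x ∷ v) i < j
  lt (suc i) _ = ℕP.≤-<-trans (part-antitone-+ (x ∷ v) P 0 i) (ℕP.≰⇒> jx)
  z : conj v j ≡ 0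
  z = conj-zero v j (λ { (suc i) _ → lt (suc (suc i)) (s≤s z≤n) })
  f1 : ∀ i → 1 ≤ i → i ≤ conj v j → j ≤ part (x ∷ v) i
  f1 (suc i) _ h rewrite z = ⊥-elim (ℕP.<⇒≱ (s≤s z≤n) h)
  f2 : ∀ i → conj v j < i → part (x ∷ v) i < j
  f2 (suc i) _ = lt (suc i) (s≤s z≤n)

record Cut (f : ℕ → ℤ) (x : ℤ) (n : ℕ) : Set where
  constructor cut
  field
    r   : ℕ
    r≤n : r ≤ n
    x<f : ∀ i → 1 ≤ i → i ≤ r → x ℤ.< f i
    f≤x : ∀ i → r < i → i ≤ n → f i ℤ.≤ x

antitone-cut : ∀ (f : ℕ → ℤ) x n → (∀ i → 1 ≤ i → suc i ≤ n → f (suc i) ℤ.≤ f i) → Cut f x n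
antitone-cut f x zero _ = cut 0 z≤n (λ { (suc i) _ () }) (λ { (suc i) _ () })
antitone-cut f x (suc n) anti with antitone-cut f x n (λ i i≥1 i<n → anti i i≥1 (ℕP.m≤n⇒m≤1+n i<n))
... | cut r r≤n x<f f≤x with ℕP.m≤n⇒m<n∨m≡n r≤n
...   | inj₁ r<n = cut r (ℕP.m≤n⇒m≤1+n r≤n) x<f f≤x′
  where
  f≤x′ : ∀ i → r < i → i ≤ suc n → f i ℤ.≤ x
  f≤x′ i r<i i≤1+n with ℕP.m≤n⇒m<n∨m≡n i≤1+n
  ... | inj₁ (s≤s i≤n) = f≤x i r<i i≤n
  ... | inj₂ refl = ℤP.≤-trans (anti n (ℕP.≤-trans (s≤s z≤n) r<n) ℕP.≤-refl) (f≤x n r<n ℕP.≤-refl)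
...   | inj₂ refl with x ℤP.<? f (suc r)
...     | yes x<f[1+r] = cut (suc r) ℕP.≤-refl x<f′ (λ i r<i i≤r → ⊥-elim (ℕP.<⇒≱ r<i i≤r))
  where
  x<f′ : ∀ i → 1 ≤ i → i ≤ suc r → x ℤ.< f i
  x<f′ i i≥1 i≤1+r with ℕP.m≤n⇒m<n∨m≡n i≤1+r
  ... | inj₁ (s≤s i≤r) = x<f i i≥1 i≤r
  ... | inj₂ refl = x<f[1+r]
...     | no x≮f[1+r] = cut r (ℕP.n≤1+n r) x<f f≤x′
  where
  f≤x′ : ∀ i → r < i → i ≤ suc r → f i ℤ.≤ x
  f≤x′ i r<i i≤1+r with ℕP.m≤n⇒m<n∨m≡n i≤1+r
  ... | inj₁ (s≤s i≤r) = ⊥-elim (ℕP.<⇒≱ r<i i≤r)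
  ... | inj₂ refl = ℤP.≮⇒≥ x≮f[1+r]

∨≡true⇒⊎ : ∀ {P : Set} (d : Dec P) b → ⌊ d ⌋ ∨ b ≡ true → P ⊎ (b ≡ true)
∨≡true⇒⊎ (yes p) b h = inj₁ p
∨≡true⇒⊎ (no _) b h = inj₂ h

⌊⌋≡true : ∀ {P : Set} (d : Dec P) → P → ⌊ d ⌋ ≡ true
⌊⌋≡true (yes _) p = refl
⌊⌋≡true (no ¬p) p = ⊥-elim (¬p p)

occupied-true : ∀ (ρ : ℕ → ℕ) n c i → 1 ≤ i → i ≤ n → c ≡ + ρ i - + i → occupied ρ n c ≡ true
occupied-true ρ zero c (suc i) _ () e
occupied-true ρ (suc n) c i h1 h2 e with ℕP.m≤n⇒m<n∨m≡n h2
... | inj₁ (s≤s h) = trans (cong (λ z → ⌊ c ℤ.≟ (+ ρ (suc n) - + suc n) ⌋ ∨ z) (occupied-true ρ n c i h1 h e))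
        (BP.∨-zeroʳ _)
... | inj₂ refl = cong (λ z → z ∨ occupied ρ n c) (⌊⌋≡true (c ℤ.≟ (+ ρ (suc n) - + suc n)) e)

occupied-sound : ∀ (ρ : ℕ → ℕ) n c → occupied ρ n c ≡ true → Σ ℕ λ i → 1 ≤ i × i ≤ n × c ≡ + ρ i - + i
occupied-sound ρ zero c ()
occupied-sound ρ (suc n) c h with ∨≡true⇒⊎ (c ℤ.≟ (+ ρ (suc n) - + suc n)) (occupied ρ n c) h
... | inj₁ e = suc n , s≤s z≤n , ℕP.≤-refl , e
... | inj₂ h' with occupied-sound ρ n c h'
...   | i , a , b , e = i , a , ℕP.m≤n⇒m≤1+n b , e

≢-sum-below : ∀ v r i j → i ≤ r → j ≤ v → v + r + 1 ≢ i + j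
≢-sum-below v r i j a b e = ℕP.<-irrefl refl (subst (λ z → i + j < z) e h)
  where h : i + j < v + r + 1
        h = ℕP.≤-<-trans (ℕP.≤-trans (ℕP.+-mono-≤ a b) (ℕP.≤-reflexive (ℕP.+-comm r v))) (ℕP.m<m+n (v + r) (s≤s z≤n))

≢-sum-above : ∀ v r i j → r < i → v < j → v + r + 1 ≢ i + j
≢-sum-above v r i j a b e = ℕP.<-irrefl refl (subst (λ z → z < i + j) e h)
  where h : v + r + 1 < i + j
        h = subst₂ _≤_ (r1 v r) (ℕP.+-comm j i) (ℕP.+-mono-≤ b a)
          where r1 : ∀ v r → suc v + suc r ≡ suc (v + r + 1)
                r1 = NS.solve-∀

mirror-difference : ∀ a b c d → ℤ.- + 1 - (a - b) ≡ c - d → a ℤ.+ c ℤ.+ + 1 ≡ b ℤ.+ d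
mirror-difference a b c d e = trans (r1 a b c d) (trans (cong (λ z → b ℤ.+ d ℤ.+ (z - (ℤ.- + 1 - (a - b)))) (sym e)) (r2 a b d))
  where r1 : ∀ a b c d → a ℤ.+ c ℤ.+ + 1 ≡ b ℤ.+ d ℤ.+ ((c - d) - (ℤ.- + 1 - (a - b)))
        r1 = solve-∀
        r2 : ∀ a b d → b ℤ.+ d ℤ.+ ((ℤ.- + 1 - (a - b)) - (ℤ.- + 1 - (a - b))) ≡ b ℤ.+ d
        r2 = solve-∀

+[a+b+1] : ∀ a b → + (a + b + 1) ≡ + a ℤ.+ + b ℤ.+ + 1
+[a+b+1] a b = trans (ℤP.pos-+ (a + b) 1) (cong (λ z → z ℤ.+ + 1) (ℤP.pos-+ a b))

zero⊎≥1 : ∀ n → n ≡ 0 ⊎ 1 ≤ n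
zero⊎≥1 zero = inj₁ refl
zero⊎≥1 (suc n) = inj₂ (s≤s z≤n)

point-mirror : ∀ p c → point (mirror p) c ≡ point p (mirror c)
point-mirror p c = sym (trans (χ-mirror p (p ℤ.+ + 1) c) (cong₂ (λ u w → χ u w c) (ring₁ p) (ring₂ p)))
  where ring₁ : ∀ p → ℤ.- (p ℤ.+ + 1) ≡ ℤ.- + 1 - p
        ring₁ = solve-∀
        ring₂ : ∀ p → ℤ.- p ≡ ℤ.- + 1 - p ℤ.+ + 1
        ring₂ = solve-∀

conj-unoccupied-above : ∀ {ℓ} (v : Vec ℕ ℓ) L c → + ℓ ℤ.≤ c → occupied (conj v) L c ≡ false
conj-unoccupied-above {ℓ} v L c ℓ≤c = occupied-false (conj v) L c (λ j j≥1 _ c≡ → ℤP.<-irrefl (sym c≡)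
   (ℤP.<-≤-trans (subst₂ ℤ._<_ refl (ℤP.+-identityʳ (+ ℓ))
     ([+p]-[+j]-mono-< {p = ℓ} {p' = conj v j} {j = 0} {j' = j} (conj-≤ v j) j≥1)) ℓ≤c))

-- Within the window [-ℓ, L), every column is either a site of v or the mirror
-- image of a site of the conjugate v' (with L parts), never both.
module ConjugateSites {ℓ} (v : Vec ℕ ℓ) (P : IsPartition v) (L : ℕ) (v≤L : ∀ j → part v j ≤ L) where

  site-excludes-conjugate-site : ∀ x i → 1 ≤ i → i ≤ ℓ → x ≡ site v i →
    ∀ j → 1 ≤ j → j ≤ L → mirror x ≢ + conj v j - + j
  site-excludes-conjugate-site x i i≥1 i≤ℓ refl j j≥1 j≤L e with ℕP.≤-<-connex i (conj v j)
  ... | inj₁ i≤v'ⱼ = ≢-sum-below (part v i) (conj v j) i j i≤v'ⱼ (proj₁ (conj-char v P j j≥1) i i≥1 i≤v'ⱼ) sum-eq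
    where sum-eq = ℤP.+-injective (trans (+[a+b+1] (part v i) (conj v j))
                     (trans (mirror-difference (+ part v i) (+ i) (+ conj v j) (+ j) e) (sym (ℤP.pos-+ i j))))
  ... | inj₂ v'ⱼ<i = ≢-sum-above (part v i) (conj v j) i j v'ⱼ<i (proj₂ (conj-char v P j j≥1) i v'ⱼ<i) sum-eq
    where sum-eq = ℤP.+-injective (trans (+[a+b+1] (part v i) (conj v j))
                     (trans (mirror-difference (+ part v i) (+ i) (+ conj v j) (+ j) e) (sym (ℤP.pos-+ i j))))

  -- If x is not a site, the conjugate site hitting mirror x belongs to the row
  -- j = x + r + 1, where r counts the sites to the right of x.
  module NonSite (x : ℤ) (-ℓ≤x : ℤ.- + ℓ ℤ.≤ x) (x<L : x ℤ.< + L) (x≢site : ∀ i → 1 ≤ i → i ≤ ℓ → x ≢ site v i) where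

    open Cut (antitone-cut (site v) x ℓ (λ i i≥1 _ → ℤP.<⇒≤ (site-strict v P i≥1 (ℕP.n<1+n i))))
      renaming (r≤n to r≤ℓ)

    site<x : ∀ i → r < i → i ≤ ℓ → site v i ℤ.< x
    site<x i r<i i≤ℓ = ℤP.≤∧≢⇒< (f≤x i r<i i≤ℓ) (λ e → x≢site i (ℕP.≤-trans (s≤s z≤n) r<i) i≤ℓ (sym e))

    0≤x+r : + 0 ℤ.≤ x ℤ.+ + r
    0≤x+r with ℕP.m≤n⇒m<n∨m≡n r≤ℓ
    ... | inj₂ r≡ℓ rewrite r≡ℓ = subst₂ ℤ._≤_ (ring (+ ℓ)) refl (ℤP.+-monoˡ-≤ (+ ℓ) -ℓ≤x)
      where ring : ∀ l → ℤ.- l ℤ.+ l ≡ + 0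
            ring = solve-∀
    ... | inj₁ r<ℓ = subst₂ ℤ._≤_ (ring (+ r)) refl
        (ℤP.+-monoˡ-≤ (+ r) (<⇒+1≤ (ℤP.≤-<-trans lower (site<x (suc r) ℕP.≤-refl r<ℓ))))
      where lower : ℤ.- (+ 1 ℤ.+ + r) ℤ.≤ site v (suc r)
            lower = subst₂ ℤ._≤_ (ℤP.+-identityˡ _) refl
              ([+p]-[+j]-mono-≤ {p = part v (suc r)} {p' = 0} {j = suc r} {j' = suc r} z≤n ℕP.≤-refl)
            ring : ∀ r → ℤ.- (+ 1 ℤ.+ r) ℤ.+ + 1 ℤ.+ r ≡ + 0
            ring = solve-∀

    t : ℕ
    t = ℤ.∣ x ℤ.+ + r ∣

    +t≡x+r : + t ≡ x ℤ.+ + r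
    +t≡x+r = ℤP.0≤i⇒+∣i∣≡i 0≤x+r

    j : ℕ
    j = suc t

    +j≡x+r+1 : + j ≡ + 1 ℤ.+ (x ℤ.+ + r)
    +j≡x+r+1 = cong (λ z → + 1 ℤ.+ z) +t≡x+r

    j≤long-rows : ∀ i → 1 ≤ i → i ≤ r → j ≤ part v i
    j≤long-rows i i≥1 i≤r = ℕP.≤-trans (ℤP.drop‿+≤+ j≤v[r]) (part-antitone v P i≥1 i≤r)
      where
      j≤v[r] : + j ℤ.≤ + part v r
      j≤v[r] = subst₂ ℤ._≤_ (trans (ring₁ x (+ r)) (sym +j≡x+r+1)) (ring₂ (+ part v r) (+ r))
        (ℤP.+-monoˡ-≤ (+ r) (<⇒+1≤ (x<f r (ℕP.≤-trans i≥1 i≤r) ℕP.≤-refl)))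
        where ring₁ : ∀ x r → x ℤ.+ + 1 ℤ.+ r ≡ + 1 ℤ.+ (x ℤ.+ r)
              ring₁ = solve-∀
              ring₂ : ∀ p r → p - r ℤ.+ r ≡ p
              ring₂ = solve-∀

    short-rows<j : ∀ i → r < i → part v i < j
    short-rows<j i r<i = ℕP.≤-<-trans (part-antitone v P (s≤s z≤n) r<i) v[1+r]<j
      where
      v[1+r]<j : part v (suc r) < j
      v[1+r]<j with ℕP.m≤n⇒m<n∨m≡n r≤ℓ
      ... | inj₂ r≡ℓ rewrite part-beyond v (suc r) (s≤s (ℕP.≤-reflexive (sym r≡ℓ))) = s≤s z≤n
      ... | inj₁ r<ℓ = ℤP.drop‿+<+ (subst₂ ℤ._<_ (ring₂ (+ part v (suc r)) (+ r)) (trans (ring₁ x (+ r)) (sym +j≡x+r+1))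
                         (ℤP.+-monoˡ-< (+ 1 ℤ.+ + r) (site<x (suc r) ℕP.≤-refl r<ℓ)))
        where ring₁ : ∀ x r → x ℤ.+ (+ 1 ℤ.+ r) ≡ + 1 ℤ.+ (x ℤ.+ r)
              ring₁ = solve-∀
              ring₂ : ∀ p r → p - (+ 1 ℤ.+ r) ℤ.+ (+ 1 ℤ.+ r) ≡ p
              ring₂ = solve-∀

    conj≡r : conj v j ≡ r
    conj≡r with ℕP.<-cmp r (conj v j)
    ... | tri< r<v'ⱼ _ _ = ⊥-elim (ℕP.<⇒≱ (short-rows<j (conj v j) r<v'ⱼ)
            (proj₁ (conj-char v P j (s≤s z≤n)) (conj v j) (ℕP.≤-trans (s≤s z≤n) r<v'ⱼ) ℕP.≤-refl))
    ... | tri≈ _ r≡v'ⱼ _ = sym r≡v'ⱼ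
    ... | tri> _ _ v'ⱼ<r = ⊥-elim (ℕP.<⇒≱ (proj₂ (conj-char v P j (s≤s z≤n)) r v'ⱼ<r)
            (j≤long-rows r (ℕP.≤-trans (s≤s z≤n) v'ⱼ<r) ℕP.≤-refl))

    j≤L : j ≤ L
    j≤L with zero⊎≥1 r
    ... | inj₁ r≡0 = ℤP.drop‿+<+ (subst₂ ℤ._<_
            (sym (trans +t≡x+r (trans (cong (λ z → x ℤ.+ + z) r≡0) (ℤP.+-identityʳ x)))) refl x<L)
    ... | inj₂ r≥1 = ℕP.≤-trans (j≤long-rows r r≥1 ℕP.≤-refl) (v≤L r)

    mirror-x≡conj-site : mirror x ≡ + conj v j - + j
    mirror-x≡conj-site rewrite conj≡r = trans (ring x (+ r)) (cong (λ z → + r - z) (sym +j≡x+r+1))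
      where ring : ∀ x r → ℤ.- + 1 - x ≡ r - (+ 1 ℤ.+ (x ℤ.+ r))
            ring = solve-∀

  unoccupied⇒not-site : ∀ x → occupied (part v) ℓ x ≡ false → ∀ i → 1 ≤ i → i ≤ ℓ → x ≢ site v i
  unoccupied⇒not-site x unocc i i≥1 i≤ℓ e with trans (sym unocc) (occupied-true (part v) ℓ x i i≥1 i≤ℓ e)
  ... | ()

  conj-complement : ∀ x → ℤ.- + ℓ ℤ.≤ x → x ℤ.< + L →
    bit (occupied (conj v) L (mirror x)) + bit (occupied (part v) ℓ x) ≡ 1
  conj-complement x -ℓ≤x x<L with occupied (part v) ℓ x in occ
  ... | true with occupied-sound (part v) ℓ x occ
  ...   | i , i≥1 , i≤ℓ , e rewrite occupied-false (conj v) L (mirror x)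
            (site-excludes-conjugate-site x i i≥1 i≤ℓ e) = refl
  conj-complement x -ℓ≤x x<L | false = cong (λ b → bit b + 0)
    (occupied-true (conj v) L (mirror x) j (s≤s z≤n) j≤L mirror-x≡conj-site)
    where open NonSite x -ℓ≤x x<L (unoccupied⇒not-site x occ)

  conj-complement-window : ∀ c → ℤ.- + L ℤ.≤ c →
    bit (occupied (conj v) L c) + sumN ℓ (λ i → point (mirror (site v i)) c) ≡ χ (ℤ.- + L) (+ ℓ) c
  conj-complement-window c -L≤c with position? (ℤ.- + L) (+ ℓ) c
  ... | below c<-L = ⊥-elim (ℤP.<⇒≱ c<-L -L≤c)
  ... | above _ ℓ≤c rewrite conj-unoccupied-above v L c ℓ≤c | χ-above {ℤ.- + L} {+ ℓ} ℓ≤c =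
    sumN-0 ℓ (λ i _ i≤ℓ → χ-above {mirror (site v i)} (subst₂ ℤ._≤_ (ring (site v i)) refl
       (ℤP.≤-trans (ℤP.neg-mono-≤ (site≥-ℓ v i i≤ℓ)) (subst₂ ℤ._≤_ (sym (ℤP.neg-involutive (+ ℓ))) refl ℓ≤c))))
    where ring : ∀ p → ℤ.- p ≡ ℤ.- + 1 - p ℤ.+ + 1
          ring = solve-∀
  ... | inside -L≤c c<ℓ rewrite χ-inside -L≤c c<ℓ = begin
    bit (occupied (conj v) L c) + sumN ℓ (λ i → point (mirror (site v i)) c)
      ≡⟨ cong₂ _+_ (cong (λ z → bit (occupied (conj v) L z)) (sym (mirror-involutive c)))
           (sumN-cong ℓ (λ i _ _ → point-mirror (site v i) c)) ⟩
    bit (occupied (conj v) L (mirror (mirror c))) + sumN ℓ (λ i → point (site v i) (mirror c))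
      ≡⟨ cong (λ z → bit (occupied (conj v) L (mirror (mirror c))) + z) (bit-occupied v P ℓ (mirror c)) ⟨
    bit (occupied (conj v) L (mirror (mirror c))) + bit (occupied (part v) ℓ (mirror c))
      ≡⟨ conj-complement (mirror c) -ℓ≤mirror-c mirror-c<L ⟩
    1 ∎
    where
    open ≡-Reasoning
    -ℓ≤mirror-c : ℤ.- + ℓ ℤ.≤ mirror c
    -ℓ≤mirror-c = subst₂ ℤ._≤_ refl (ring c) (ℤP.neg-mono-≤ (<⇒+1≤ c<ℓ))
      where ring : ∀ c → ℤ.- (c ℤ.+ + 1) ≡ ℤ.- + 1 - c
            ring = solve-∀
    mirror-c<L : mirror c ℤ.< + L
    mirror-c<L = +1≤⇒< (subst₂ ℤ._≤_ (ring c) (ℤP.neg-involutive (+ L)) (ℤP.neg-mono-≤ -L≤c))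
      where ring : ∀ c → ℤ.- c ≡ ℤ.- + 1 - c ℤ.+ + 1
            ring = solve-∀

-- The purple row

≤-by-difference : ∀ {p q} u v → p ℤ.≤ q → v - u ≡ q - p → u ℤ.≤ v
≤-by-difference {p} {q} u v h e = subst₂ ℤ._≤_ (e1 p u) (trans (e2 q u p) (trans (cong (λ z → z ℤ.+ u) (sym e)) (e3 v u))) (ℤP.+-monoˡ-≤ (u - p) h)
  where e1 : ∀ p u → p ℤ.+ (u - p) ≡ u
        e1 = solve-∀
        e2 : ∀ q u p → q ℤ.+ (u - p) ≡ (q - p) ℤ.+ u
        e2 = solve-∀
        e3 : ∀ v u → v - u ℤ.+ u ≡ v
        e3 = solve-∀

<-by-difference : ∀ {p q} u v → p ℤ.< q → v - u ≡ q - p → u ℤ.< v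
<-by-difference {p} {q} u v h e = subst₂ ℤ._<_ (e1 p u) (trans (e2 q u p) (trans (cong (λ z → z ℤ.+ u) (sym e)) (e3 v u))) (ℤP.+-monoˡ-< (u - p) h)
  where e1 : ∀ p u → p ℤ.+ (u - p) ≡ u
        e1 = solve-∀
        e2 : ∀ q u p → q ℤ.+ (u - p) ≡ (q - p) ℤ.+ u
        e2 = solve-∀
        e3 : ∀ v u → v - u ℤ.+ u ≡ v
        e3 = solve-∀

-- One colour of the purple row, on the conjugate partitions: its path leaves
-- column c to the right iff mirror (b i) ≤ c < mirror (a i) for some i.
module PurpleColour {ℓ} (lv mv : Vec ℕ ℓ) (Pl : IsPartition lv) (Pm : IsPartition mv)
    (HS : HorizontalStrip lv mv) (L₂ : ℕ) (lL : ∀ j → part lv j ≤ L₂) (mL : ∀ j → part mv j ≤ L₂) where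

  open Strip lv mv HS public

  path span bottomSites topSites window bottom top : ℤ → ℕ
  path c = sumN ℓ (λ i → χ (mirror (b i)) (mirror (a i)) c)
  span c = sumN ℓ (λ i → χ (mirror (b i)) (ℤ.- a i) c)
  bottomSites c = sumN ℓ (λ i → point (mirror (a i)) c)
  topSites c = sumN ℓ (λ i → point (mirror (b i)) c)
  window c = χ (ℤ.- + L₂) (+ ℓ) c
  bottom c = bit (occupied (conj mv) L₂ c)
  top c = bit (occupied (conj lv) L₂ c)

  bottom-complement : ∀ c → ℤ.- + L₂ ℤ.≤ c → bottom c + bottomSites c ≡ window c
  bottom-complement c h = ConjugateSites.conj-complement-window mv Pm L₂ mL c h

  top-complement : ∀ c → ℤ.- + L₂ ℤ.≤ c → top c + topSites c ≡ window c
  top-complement c h = ConjugateSites.conj-complement-window lv Pl L₂ lL c h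

  mirror+1 : ∀ p → ℤ.- + 1 - p ℤ.+ + 1 ≡ ℤ.- p
  mirror+1 = solve-∀

  mirror-mono : ∀ i → 1 ≤ i → mirror (b i) ℤ.≤ mirror (a i)
  mirror-mono i h = ≤-by-difference (mirror (b i)) (mirror (a i)) (a≤b i h) (e (a i) (b i))
    where e : ∀ a b → (ℤ.- + 1 - a) - (ℤ.- + 1 - b) ≡ b - a
          e = solve-∀

  span-top : ∀ c → topSites c + path (c - + 1) ≡ span c
  span-top c = trans (sym (sumN-+ ℓ _ _)) (sumN-cong ℓ (λ i h1 _ →
    trans (cong₂ (λ u w → χ (mirror (b i)) u c + w) (mirror+1 (b i)) (trans (χ-shift (mirror (b i)) (mirror (a i)) c) (cong₂ (λ u w → χ u w c) (mirror+1 (b i)) (mirror+1 (a i)))))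
      (χ-concat (subst₂ ℤ._≤_ refl (mirror+1 (b i)) (ℤP.i≤i+j (mirror (b i)) (+ 1))) (ℤP.neg-mono-≤ (a≤b i h1)) c)))

  span-bottom : ∀ c → path c + bottomSites c ≡ span c
  span-bottom c = trans (sym (sumN-+ ℓ _ _)) (sumN-cong ℓ (λ i h1 _ →
    trans (cong (λ u → χ (mirror (b i)) (mirror (a i)) c + χ (mirror (a i)) u c) (mirror+1 (a i)))
      (χ-concat (mirror-mono i h1) (subst₂ ℤ._≤_ refl (mirror+1 (a i)) (ℤP.i≤i+j (mirror (a i)) (+ 1))) c)))

  span≤1 : ∀ c → span c ≤ 1
  span≤1 c = ℕP.≤-trans (ℕP.≤-reflexive (sumN-cong ℓ (λ i _ _ →
      trans (cong (λ u → χ u (ℤ.- a i) c) (e (b i))) (sym (χ-mirror (a i) (b i ℤ.+ + 1) c))))) (sites-disjoint (mirror c))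
    where e : ∀ b → ℤ.- + 1 - b ≡ ℤ.- (b ℤ.+ + 1)
          e = solve-∀

  span≤window : ∀ c → ℤ.- + L₂ ℤ.≤ c → span c ≤ window c
  span≤window c h with position? (ℤ.- + L₂) (+ ℓ) c
  ... | below l = ⊥-elim (ℤP.<⇒≱ l h)
  ... | inside h1 h2 rewrite χ-inside h1 h2 = span≤1 c
  ... | above _ h2 rewrite sumN-0 ℓ (λ i _ i≤ → χ-above {mirror (b i)} {ℤ.- a i}
          (ℤP.≤-trans (subst₂ ℤ._≤_ refl (ℤP.neg-involutive (+ ℓ)) (ℤP.neg-mono-≤ (site≥-ℓ mv i i≤))) h2)) = z≤n

  flow-conserved : ∀ c → ℤ.- + L₂ ℤ.≤ c → bottom c + path (c - + 1) ≡ top c + path c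
  flow-conserved c -L≤c = ℕP.+-cancelʳ-≡ (bottomSites c + topSites c) _ _ (begin
    bottom c + path (c - + 1) + (bottomSites c + topSites c)
      ≡⟨ ring₁ (bottom c) (path (c - + 1)) (bottomSites c) (topSites c) ⟩
    (bottom c + bottomSites c) + (topSites c + path (c - + 1))
      ≡⟨ cong₂ _+_ (bottom-complement c -L≤c) (span-top c) ⟩
    window c + span c
      ≡⟨ cong₂ _+_ (top-complement c -L≤c) (span-bottom c) ⟨
    (top c + topSites c) + (path c + bottomSites c)
      ≡⟨ ring₂ (top c) (path c) (bottomSites c) (topSites c) ⟨
    top c + path c + (bottomSites c + topSites c) ∎)
    where
    open ≡-Reasoning
    ring₁ : ∀ x y u w → x + y + (u + w) ≡ (x + u) + (w + y)
    ring₁ = NS.solve-∀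
    ring₂ : ∀ x y u w → x + y + (u + w) ≡ (x + w) + (y + u)
    ring₂ = NS.solve-∀

  left≤top : ∀ c → ℤ.- + L₂ ℤ.≤ c → path (c - + 1) ≤ top c
  left≤top c h = ℕP.+-cancelˡ-≤ (topSites c) _ _ (subst₂ _≤_ (sym (span-top c)) (trans (sym (top-complement c h)) (ℕP.+-comm (top c) (topSites c))) (span≤window c h))

  path≤span : ∀ c → path c ≤ span c
  path≤span c = ℕP.≤-trans (ℕP.m≤m+n (path c) (bottomSites c)) (ℕP.≤-reflexive (span-bottom c))

  path≤1 : ∀ c → path c ≤ 1
  path≤1 c = ℕP.≤-trans (path≤span c) (span≤1 c)

  path≤window : ∀ c → ℤ.- + L₂ ℤ.≤ c → path c ≤ window c
  path≤window c h = ℕP.≤-trans (path≤span c) (span≤window c h)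

  top∸left+span≡window : ∀ c → ℤ.- + L₂ ℤ.≤ c → (top c ∸ path (c - + 1)) + span c ≡ window c
  top∸left+span≡window c -L≤c = begin
    (top c ∸ path (c - + 1)) + span c
      ≡⟨ cong (λ z → (top c ∸ path (c - + 1)) + z) (span-top c) ⟨
    (top c ∸ path (c - + 1)) + (topSites c + path (c - + 1))
      ≡⟨ ring (top c ∸ path (c - + 1)) (topSites c) (path (c - + 1)) ⟩
    (top c ∸ path (c - + 1)) + path (c - + 1) + topSites c
      ≡⟨ cong (_+ topSites c) (ℕP.m∸n+n≡m (left≤top c -L≤c)) ⟩
    top c + topSites c
      ≡⟨ top-complement c -L≤c ⟩
    window c ∎
    where
    open ≡-Reasoning
    ring : ∀ x y z → x + (y + z) ≡ x + z + y
    ring = NS.solve-∀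

module PurpleRow {k ℓ} (lam mu : Fin k → Vec ℕ ℓ) (Pl : ∀ a → IsPartition (lam a)) (Pm : ∀ a → IsPartition (mu a))
    (HS : ∀ a → HorizontalStrip (lam a) (mu a)) (L₂ N₂ : ℕ)
    (λ≤L₂ : ∀ a i → lookup (lam a) i ≤ L₂) (μ≤L₂ : ∀ a i → lookup (mu a) i ≤ L₂) (ℓ≤N₂ : ℓ ≤ N₂) where

  module C (a : Fin k) = PurpleColour (lam (F.opposite a)) (mu (F.opposite a)) (Pl (F.opposite a)) (Pm (F.opposite a))
    (HS (F.opposite a)) L₂ (part-bound (lam (F.opposite a)) L₂ (λ≤L₂ (F.opposite a)))
    (part-bound (mu (F.opposite a)) L₂ (μ≤L₂ (F.opposite a)))

  path top : Fin k → ℤ → ℕ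
  path a c = C.path a c
  top a c = C.top a c

  B T H : ℤ → Label k
  B c = boundaryLabel (conjTuple mu) L₂ c
  T c = boundaryLabel (conjTuple lam) L₂ c
  H c = tabulate (λ a → path a c)

  xExponent tExponent : ℤ → ℕ
  xExponent c = ΣFin k (λ a → path a c)
  tExponent c = ΣPairs k (λ a b → path a c * (top b c ∸ path b (c - + 1)))

  weight : ℤ → Mono
  weight c = (xExponent c , + tExponent c)

  bottom+left≡top+right : ∀ c → ℤ.- + L₂ ℤ.≤ c → V.zipWith _+_ (B c) (H (c - + 1)) ≡ V.zipWith _+_ (T c) (H c)
  bottom+left≡top+right c h rewrite boundaryLabel-tabulate (conjTuple mu) L₂ c | boundaryLabel-tabulate (conjTuple lam) L₂ c =
    trans (zipWith-tabulate _+_ _ _) (trans (VP.tabulate-cong (λ a → C.flow-conserved a c h)) (sym (zipWith-tabulate _+_ _ _)))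

  left≤top-all : ∀ c → ℤ.- + L₂ ℤ.≤ c → allᵛ (λ kc jc → ⌊ jc ℕ.≤? kc ⌋) (T c) (H (c - + 1)) ≡ true
  left≤top-all c h rewrite boundaryLabel-tabulate (conjTuple lam) L₂ c = allᵛ-tabulate _ _ _ (λ a → ⌊⌋≡true (path a (c - + 1) ℕ.≤? top a c) (C.left≤top a c h))

  top∸left : ∀ c → V.zipWith _∸_ (T c) (H (c - + 1)) ≡ tabulate (λ a → top a c ∸ path a (c - + 1))
  top∸left c rewrite boundaryLabel-tabulate (conjTuple lam) L₂ c = zipWith-tabulate _∸_ _ _

  forced : ∀ c → ℤ.- + L₂ ℤ.≤ c → ForcedRow.Forced purple B T H weight c
  forced c h = IsBinary-tabulate _ (λ a → C.path≤1 a c) ,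
    trans (purple-just (B c) (H (c - + 1)) (T c) (H c) (bottom+left≡top+right c h) (left≤top-all c h))
      (cong just (cong₂ _,_ (size-tabulate (λ a → path a c))
        (cong +_ (trans (cong (φ (H c)) (top∸left c)) (φ-tabulate (λ a → path a c) (λ a → top a c ∸ path a (c - + 1))))))) ,
    (λ L ne → purple-nothing (B c) (H (c - + 1)) (T c) L (H c) (bottom+left≡top+right c h) ne)

  cols : List ℤ
  cols = columns L₂ N₂

  left-boundary : emptyLabel k ≡ H (ℤ.- + L₂ - + 1)
  left-boundary = trans (sym (tabulate-zero k)) (VP.tabulate-cong (λ a → sym (sumN-0 ℓ (λ i h1 h2 →
    χ-below {mirror (C.b a i)} (<-by-difference (ℤ.- + L₂ - + 1) (mirror (C.b a i))
      ([+p]-[+j]-mono-< {p = L₂} {p' = part (lam (F.opposite a)) i} {j = 0} {j' = i} (part-bound (lam (F.opposite a)) L₂ (λ≤L₂ (F.opposite a)) i) h1)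
      (e (+ L₂) (C.b a i)))))))
    where e : ∀ L b → ℤ.- + 1 - b - (ℤ.- L - + 1) ≡ L - + 0 - b
          e = solve-∀

  right-boundary : H (ℤ.- + L₂ ℤ.+ + (L₂ + N₂ + 1) - + 1) ≡ emptyLabel k
  right-boundary rewrite lastColumn L₂ N₂ = trans (VP.tabulate-cong (λ a → sumN-0 ℓ (λ i h1 h2 → χ-above {mirror (C.b a i)} {mirror (C.a a i)}
    (ℤP.≤-trans (≤-by-difference (mirror (C.a a i)) (+ ℓ - + 1) (site≥-ℓ (mu (F.opposite a)) i h2) (e (+ ℓ) (C.a a i)))
      (ℤP.≤-trans (ℤP.i-j≤i (+ ℓ) (+ 1)) (ℤ.+≤+ ℓ≤N₂)))))) (tabulate-zero k)
    where e : ∀ l a → l - + 1 - (ℤ.- + 1 - a) ≡ a - ℤ.- l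
          e = solve-∀

  purple-row : 𝓛ᴾ (conjTuple lam) (conjTuple mu) L₂ N₂ ≡ (sumL xExponent cols , + sumL tExponent cols) ∷ []
  purple-row = trans (ForcedRow.rowPF-forced purple B T H weight (ℤ.- + L₂) (L₂ + N₂ + 1) (emptyLabel k) left-boundary (λ x h → forced x (proj₁ h)) right-boundary)
    (cong (_∷ []) (foldMono-sum weight xExponent tExponent (λ x → refl) cols))

-- The exponent of t

columnsEnd : ∀ L N → ℤ.- + L ℤ.+ + (L + N + 1) ≡ + N ℤ.+ + 1
columnsEnd L N rewrite ℤP.pos-+ (L + N) 1 | ℤP.pos-+ L N = e (+ L) (+ N)
  where e : ∀ l n → ℤ.- l ℤ.+ (l ℤ.+ n ℤ.+ + 1) ≡ n ℤ.+ + 1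
        e = solve-∀

site-shift : ∀ l m j → m ≤ l → + l - + j ≡ (+ m - + j) ℤ.+ + (l ∸ m)
site-shift l m j m≤l rewrite sym (trans (ℤP.[+m]-[+n]≡m⊖n l m) (ℤP.⊖-≥ m≤l)) = ring (+ l) (+ m) (+ j)
  where ring : ∀ l m j → l - j ≡ (m - j) ℤ.+ (l - m)
        ring = solve-∀

χ-crossing : ∀ a b c d → a ℤ.≤ b → c ℤ.≤ d →
  χ a b c + bit ⌊ c ℤP.<? a ⌋ ≡ bit ⌊ d ℤP.<? b ⌋ + χ (c ℤ.+ + 1) (d ℤ.+ + 1) b
χ-crossing a b c d ab cd with c ℤP.<? a
... | yes ca rewrite χ-below {a} {b} ca with d ℤP.<? b
...   | yes db rewrite χ-above {c ℤ.+ + 1} {d ℤ.+ + 1} (<⇒+1≤ db) = refl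
...   | no db rewrite χ-inside {c ℤ.+ + 1} {d ℤ.+ + 1} {b} (<⇒+1≤ (ℤP.<-≤-trans ca ab)) (≤⇒<+1 (ℤP.≮⇒≥ db)) = refl
χ-crossing a b c d ab cd | no ca with position? a b c
...   | below x = ⊥-elim (ca x)
...   | inside _ cb rewrite χ-inside {a} {b} {c} (ℤP.≮⇒≥ ca) cb with d ℤP.<? b
...     | yes db rewrite χ-above {c ℤ.+ + 1} {d ℤ.+ + 1} (<⇒+1≤ db) = refl
...     | no db rewrite χ-inside {c ℤ.+ + 1} {d ℤ.+ + 1} {b} (<⇒+1≤ cb) (≤⇒<+1 (ℤP.≮⇒≥ db)) = refl
χ-crossing a b c d ab cd | no ca | above _ bc rewrite χ-above {a} {b} {c} bc
  | χ-below {c ℤ.+ + 1} {d ℤ.+ + 1} {b} (≤⇒<+1 bc) with d ℤP.<? b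
...     | yes db = ⊥-elim (ℤP.<⇒≱ db (ℤP.≤-trans bc cd))
...     | no db = refl

mirror-≥ : ∀ p L → p ℤ.< + L → ℤ.- + L ℤ.≤ ℤ.- + 1 - p
mirror-≥ p L h = ≤-by-difference (ℤ.- + L) (ℤ.- + 1 - p) (<⇒+1≤ h) (e p (+ L))
  where e : ∀ p L → ℤ.- + 1 - p - ℤ.- L ≡ L - (p ℤ.+ + 1)
        e = solve-∀

mirror-≤ : ∀ p ℓ N → ℤ.- + ℓ ℤ.≤ p → ℓ ≤ N → ℤ.- + 1 - p ℤ.≤ + N
mirror-≤ p ℓ N h1 h2 = ℤP.≤-trans (≤-by-difference (ℤ.- + 1 - p) (+ ℓ - + 1) h1 (e p (+ ℓ))) (ℤP.≤-trans (ℤP.i-j≤i (+ ℓ) (+ 1)) (ℤ.+≤+ h2))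
  where e : ∀ p l → l - + 1 - (ℤ.- + 1 - p) ≡ p - ℤ.- l
        e = solve-∀

site< : ∀ {ℓ} (v : Vec ℕ ℓ) B → (∀ j → part v j ≤ B) → ∀ j → 1 ≤ j → site v j ℤ.< + B
site< v B h j hj = subst₂ ℤ._<_ refl (ℤP.+-identityʳ (+ B)) ([+p]-[+j]-mono-< {p = B} {p' = part v j} {j = 0} {j' = j} (h j) hj)

m≤n≤1⇒m*n≡m : ∀ {m n} → m ≤ n → n ≤ 1 → m * n ≡ m
m≤n≤1⇒m*n≡m {m} {zero} m≤0 _ = trans (ℕP.*-zeroʳ m) (sym (ℕP.n≤0⇒n≡0 m≤0))
m≤n≤1⇒m*n≡m {m} {suc zero} _ _ = ℕP.*-identityʳ m
m≤n≤1⇒m*n≡m {n = suc (suc _)} _ (s≤s ())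

sumN-*-sumN : ∀ n m (f : ℕ → ℕ) (g : ℕ → ℕ) → sumN n f * sumN m g ≡ sumN m (λ i → sumN n (λ j → f j * g i))
sumN-*-sumN n m f g = trans (sym (sumN-*ˡ m (sumN n f) g)) (sumN-cong m (λ i _ _ → sym (sumN-*ʳ n (g i) f)))

gPair : ∀ {ℓ} → Vec ℕ ℓ → Vec ℕ ℓ → ℕ
gPair {ℓ} u v = sumN ℓ (λ i → part v i) + sumN ℓ (λ i → sumN ℓ (λ j → bit ⌊ site v i ℤP.<? site u j ⌋))

g : ∀ {k ℓ} → (Fin k → Vec ℕ ℓ) → ℕ
g {k} ρ = ΣPairs k (λ a b → gPair (ρ a) (ρ b))

module ColourPair {ℓ} (lβ mβ lα mα : Vec ℕ ℓ) (Plβ : IsPartition lβ) (Pmβ : IsPartition mβ) (Plα : IsPartition lα) (Pmα : IsPartition mα)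
    (HSβ : HorizontalStrip lβ mβ) (HSα : HorizontalStrip lα mα) (L₁ N₁ L₂ N₂ : ℕ) (ℓ≤L₁ : ℓ ≤ L₁) (ℓ≤N₂ : ℓ ≤ N₂)
    (lβN : ∀ j → part lβ j ≤ N₁) (lαN : ∀ j → part lα j ≤ N₁)
    (lβL : ∀ j → part lβ j ≤ L₂) (mβL : ∀ j → part mβ j ≤ L₂) (lαL : ∀ j → part lα j ≤ L₂) (mαL : ∀ j → part mα j ≤ L₂) where

  module Wβ = WhiteColour lβ mβ Plβ Pmβ HSβ L₁ ℓ≤L₁
  module Wα = WhiteColour lα mα Plα Pmα HSα L₁ ℓ≤L₁
  module Pβ = PurpleColour lβ mβ Plβ Pmβ HSβ L₂ lβL mβL
  module Pα = PurpleColour lα mα Plα Pmα HSα L₂ lαL mαL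

  a b c d : ℕ → ℤ
  a = Wβ.a
  b = Wβ.b
  c = Wα.a
  d = Wα.b

  lenβ lenα : ℕ → ℕ
  lenβ j = part lβ j ∸ part mβ j
  lenα i = part lα i ∸ part mα i

  μα≤λα : ∀ j → 1 ≤ j → part mα j ≤ part lα j
  μα≤λα (suc j) _ = proj₁ (HSα j)

  b≡a+len : ∀ j → 1 ≤ j → b j ≡ a j ℤ.+ + lenβ j
  b≡a+len (suc j) _ = site-shift (part lβ (suc j)) (part mβ (suc j)) (suc j) (proj₁ (HSβ j))

  d≡c+len : ∀ i → 1 ≤ i → d i ≡ c i ℤ.+ + lenα i
  d≡c+len i i≥1 = site-shift (part lα i) (part mα i) i (μα≤λα i i≥1)

  colsW colsP : List ℤ
  colsW = columns L₁ N₁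
  colsP = columns L₂ N₂

  sW sP endW endP : ℤ
  sW = ℤ.- + L₁
  sP = ℤ.- + L₂
  endW = sW ℤ.+ + (L₁ + N₁ + 1)
  endP = sP ℤ.+ + (L₂ + N₂ + 1)

  sW≤site : ∀ {ℓ'} (v : Vec ℕ ℓ') j → j ≤ ℓ' → ℓ' ≤ L₁ → sW ℤ.≤ site v j
  sW≤site v j j≤ℓ' ℓ'≤L₁ = ℤP.≤-trans (neg≤ ℓ'≤L₁) (site≥-ℓ v j j≤ℓ')

  ≤N₁⇒<endW : ∀ p → p ℤ.≤ + N₁ → p ℤ.< endW
  ≤N₁⇒<endW p h = subst₂ ℤ._<_ refl (sym (columnsEnd L₁ N₁)) (≤⇒<+1 h)

  ≤N₁+1⇒≤endW : ∀ p → p ℤ.≤ + N₁ ℤ.+ + 1 → p ℤ.≤ endW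
  ≤N₁+1⇒≤endW p = subst₂ ℤ._≤_ refl (sym (columnsEnd L₁ N₁))

  ≤N₂⇒<endP : ∀ p → p ℤ.≤ + N₂ → p ℤ.< endP
  ≤N₂⇒<endP p h = subst₂ ℤ._<_ refl (sym (columnsEnd L₂ N₂)) (≤⇒<+1 h)

  d≤N₁ : ∀ i → 1 ≤ i → d i ℤ.≤ + N₁
  d≤N₁ i i≥1 = ℤP.<⇒≤ (site< lα N₁ lαN i i≥1)

  b≤N₁ : ∀ j → 1 ≤ j → b j ℤ.≤ + N₁
  b≤N₁ j j≥1 = ℤP.<⇒≤ (site< lβ N₁ lβN j j≥1)

  mirror-c≡mirror-d+len : ∀ i → 1 ≤ i → mirror (c i) ≡ mirror (d i) ℤ.+ + lenα i
  mirror-c≡mirror-d+len i i≥1 rewrite d≡c+len i i≥1 = ring (c i) (+ lenα i)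
    where ring : ∀ c l → ℤ.- + 1 - c ≡ ℤ.- + 1 - (c ℤ.+ l) ℤ.+ l
          ring = solve-∀

  sP≤mirror-d : ∀ i → 1 ≤ i → sP ℤ.≤ mirror (d i)
  sP≤mirror-d i i≥1 = mirror-≥ (d i) L₂ (site< lα L₂ lαL i i≥1)

  mirror-d+len≤endP : ∀ i → 1 ≤ i → i ≤ ℓ → mirror (d i) ℤ.+ + lenα i ℤ.≤ endP
  mirror-d+len≤endP i i≥1 i≤ℓ = subst₂ ℤ._≤_ (mirror-c≡mirror-d+len i i≥1) (sym (columnsEnd L₂ N₂))
    (ℤP.≤-trans (mirror-≤ (c i) ℓ N₂ (site≥-ℓ mα i i≤ℓ) ℓ≤N₂) (ℤP.i≤i+j (+ N₂) (+ 1)))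

  Σpath-white : sumL Wβ.path colsW ≡ sumN ℓ lenβ
  Σpath-white = trans (sumL-sumN ℓ _ colsW) (sumN-cong ℓ (λ j j≥1 j≤ℓ →
    trans (sumL-cong colsW (λ x → cong (λ z → χ (a j) z x) (b≡a+len j j≥1)))
      (sumL-χ-length sW (L₁ + N₁ + 1) (a j) (lenβ j) (sW≤site mβ j j≤ℓ ℓ≤L₁)
         (≤N₁+1⇒≤endW (a j ℤ.+ + lenβ j) (subst₂ ℤ._≤_ (b≡a+len j j≥1) refl
           (ℤP.≤-trans (b≤N₁ j j≥1) (ℤP.i≤i+j (+ N₁) (+ 1))))))))

  Σpath-purple : sumL Pα.path colsP ≡ sumN ℓ lenα
  Σpath-purple = trans (sumL-sumN ℓ _ colsP) (sumN-cong ℓ (λ i i≥1 i≤ℓ →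
    trans (sumL-cong colsP (λ x → cong (λ z → χ (mirror (d i)) z x) (mirror-c≡mirror-d+len i i≥1)))
      (sumL-χ-length sP (L₂ + N₂ + 1) (mirror (d i)) (lenα i) (sP≤mirror-d i i≥1) (mirror-d+len≤endP i i≥1 i≤ℓ))))

  whiteExponent purpleExponent : ℕ
  whiteExponent = sumL (λ x → Wβ.path x * Wα.flow x) colsW
  purpleExponent = sumL (λ x → Pα.path x * (Pβ.top x ∸ Pβ.path (x - + 1))) colsP

  overlapW overlapW′ overlapP overlapP′ : ℕ → ℕ → ℕ
  overlapW i j = sumL (λ x → χ (a j) (b j) x * χ (c i) (d i ℤ.+ + 1) x) colsW
  overlapW′ i j = sumL (λ x → χ (a j) (b j) x * χ (c i ℤ.+ + 1) (d i ℤ.+ + 1) x) colsW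
  overlapP i j = sumL (λ x → χ (mirror (d i)) (mirror (c i)) x * χ (mirror (b j)) (ℤ.- a j) x) colsP
  overlapP′ i j = sumL (λ x → χ (mirror (d i)) (mirror (c i)) x * χ (ℤ.- b j) (ℤ.- a j) x) colsP

  ΣΣ : (ℕ → ℕ → ℕ) → ℕ
  ΣΣ F = sumN ℓ (λ i → sumN ℓ (λ j → F i j))

  path*padding≡0 : ∀ x → Wβ.path x * Wα.padding x ≡ 0
  path*padding≡0 x with position? (ℤ.- + L₁) (ℤ.- + ℓ) x
  ... | below h rewrite χ-below {ℤ.- + L₁} {ℤ.- + ℓ} h = ℕP.*-zeroʳ (Wβ.path x)
  ... | above _ h rewrite χ-above {ℤ.- + L₁} {ℤ.- + ℓ} h = ℕP.*-zeroʳ (Wβ.path x)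
  ... | inside _ h rewrite sumN-0 ℓ (λ j _ j≤ℓ → χ-below {a j} {b j} (ℤP.<-≤-trans h (site≥-ℓ mβ j j≤ℓ))) = refl

  whiteExponent≡ΣoverlapW : whiteExponent ≡ ΣΣ overlapW
  whiteExponent≡ΣoverlapW = begin
    whiteExponent
      ≡⟨ sumL-cong colsW (λ x → ℕP.*-distribˡ-+ (Wβ.path x) _ (Wα.padding x)) ⟩
    sumL (λ x → Wβ.path x * sumN ℓ (λ i → χ (c i) (d i ℤ.+ + 1) x) + Wβ.path x * Wα.padding x) colsW
      ≡⟨ sumL-cong colsW (λ x → cong₂ _+_ (sumN-*-sumN ℓ ℓ _ _) (path*padding≡0 x)) ⟩
    sumL (λ x → sumN ℓ (λ i → sumN ℓ (λ j → χ (a j) (b j) x * χ (c i) (d i ℤ.+ + 1) x)) + 0) colsW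
      ≡⟨ sumL-cong colsW (λ x → ℕP.+-identityʳ _) ⟩
    sumL (λ x → sumN ℓ (λ i → sumN ℓ (λ j → χ (a j) (b j) x * χ (c i) (d i ℤ.+ + 1) x))) colsW
      ≡⟨ trans (sumL-sumN ℓ _ colsW) (sumN-cong ℓ (λ i _ _ → sumL-sumN ℓ _ colsW)) ⟩
    ΣΣ overlapW ∎
    where open ≡-Reasoning

  path*top∸left+path*span≡path : ∀ x → sP ℤ.≤ x →
    Pα.path x * (Pβ.top x ∸ Pβ.path (x - + 1)) + Pα.path x * Pβ.span x ≡ Pα.path x
  path*top∸left+path*span≡path x sP≤x = begin
    Pα.path x * (Pβ.top x ∸ Pβ.path (x - + 1)) + Pα.path x * Pβ.span x
      ≡⟨ ℕP.*-distribˡ-+ (Pα.path x) _ _ ⟨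
    Pα.path x * (Pβ.top x ∸ Pβ.path (x - + 1) + Pβ.span x)
      ≡⟨ cong (Pα.path x *_) (Pβ.top∸left+span≡window x sP≤x) ⟩
    Pα.path x * Pβ.window x
      ≡⟨ m≤n≤1⇒m*n≡m (Pα.path≤window x sP≤x) (χ≤1 (ℤ.- + L₂) (+ ℓ) x) ⟩
    Pα.path x ∎
    where open ≡-Reasoning

  purpleExponent+ΣoverlapP≡Σlenα : purpleExponent + ΣΣ overlapP ≡ sumN ℓ lenα
  purpleExponent+ΣoverlapP≡Σlenα = begin
    purpleExponent + ΣΣ overlapP
      ≡⟨ cong (λ z → purpleExponent + z) (sumN-swap ℓ ℓ overlapP) ⟩
    purpleExponent + sumN ℓ (λ j → sumN ℓ (λ i → overlapP i j))
      ≡⟨ cong (λ z → purpleExponent + z) (trans (sumL-cong colsP (λ x → sumN-*-sumN ℓ ℓ _ _))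
           (trans (sumL-sumN ℓ _ colsP) (sumN-cong ℓ (λ j _ _ → sumL-sumN ℓ _ colsP)))) ⟨
    purpleExponent + sumL (λ x → Pα.path x * Pβ.span x) colsP
      ≡⟨ sumL-+ _ _ colsP ⟨
    sumL (λ x → Pα.path x * (Pβ.top x ∸ Pβ.path (x - + 1)) + Pα.path x * Pβ.span x) colsP
      ≡⟨ sumL-cong-range sP (L₂ + N₂ + 1) (λ x x∈ → path*top∸left+path*span≡path x (proj₁ x∈)) ⟩
    sumL Pα.path colsP
      ≡⟨ Σpath-purple ⟩
    sumN ℓ lenα ∎
    where open ≡-Reasoning

  overlapW-split : ∀ i j → 1 ≤ i → i ≤ ℓ → overlapW i j ≡ χ (a j) (b j) (c i) + overlapW′ i j
  overlapW-split i j i≥1 i≤ℓ = begin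
    overlapW i j
      ≡⟨ sumL-cong colsW (λ x → cong (χ (a j) (b j) x *_) (χ-concat (ℤP.i≤i+j (c i) (+ 1))
           (ℤP.+-monoˡ-≤ (+ 1) (Wα.a≤b i i≥1)) x)) ⟨
    sumL (λ x → χ (a j) (b j) x * (point (c i) x + χ (c i ℤ.+ + 1) (d i ℤ.+ + 1) x)) colsW
      ≡⟨ trans (sumL-cong colsW (λ x → ℕP.*-distribˡ-+ (χ (a j) (b j) x) (point (c i) x) _)) (sumL-+ _ _ colsW) ⟩
    sumL (λ x → χ (a j) (b j) x * point (c i) x) colsW + overlapW′ i j
      ≡⟨ cong (_+ overlapW′ i j) (sumL-point (χ (a j) (b j)) sW (L₁ + N₁ + 1) (c i) (sW≤site mα i i≤ℓ ℓ≤L₁)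
           (≤N₁⇒<endW (c i) (ℤP.≤-trans (Wα.a≤b i i≥1) (d≤N₁ i i≥1)))) ⟩
    χ (a j) (b j) (c i) + overlapW′ i j ∎
    where open ≡-Reasoning

  overlapP-split : ∀ i j → 1 ≤ j → j ≤ ℓ → overlapP i j ≡ χ (c i ℤ.+ + 1) (d i ℤ.+ + 1) (b j) + overlapP′ i j
  overlapP-split i j j≥1 j≤ℓ = begin
    overlapP i j
      ≡⟨ sumL-cong colsP (λ x → cong (α⁻ x *_) (trans (cong (λ z → point (mirror (b j)) x + χ z (ℤ.- a j) x)
           (sym (Pβ.mirror+1 (b j)))) (χ-concat (ℤP.i≤i+j (mirror (b j)) (+ 1))
           (subst₂ ℤ._≤_ (sym (Pβ.mirror+1 (b j))) refl (ℤP.neg-mono-≤ (Wβ.a≤b j j≥1))) x))) ⟨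
    sumL (λ x → α⁻ x * (point (mirror (b j)) x + χ (ℤ.- b j) (ℤ.- a j) x)) colsP
      ≡⟨ trans (sumL-cong colsP (λ x → ℕP.*-distribˡ-+ (α⁻ x) (point (mirror (b j)) x) _)) (sumL-+ _ _ colsP) ⟩
    sumL (λ x → α⁻ x * point (mirror (b j)) x) colsP + overlapP′ i j
      ≡⟨ cong (_+ overlapP′ i j) (sumL-point α⁻ sP (L₂ + N₂ + 1) (mirror (b j))
           (mirror-≥ (b j) L₂ (site< lβ L₂ lβL j j≥1)) (≤N₂⇒<endP (mirror (b j)) (mirror-≤ (b j) ℓ N₂ (site≥-ℓ lβ j j≤ℓ) ℓ≤N₂))) ⟩
    α⁻ (mirror (b j)) + overlapP′ i j
      ≡⟨ cong (_+ overlapP′ i j) (trans (χ-mirror (mirror (d i)) (mirror (c i)) (b j))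
           (cong₂ (λ u w → χ u w (b j)) (ring (c i)) (ring (d i)))) ⟩
    χ (c i ℤ.+ + 1) (d i ℤ.+ + 1) (b j) + overlapP′ i j ∎
    where
    open ≡-Reasoning
    α⁻ : ℤ → ℕ
    α⁻ = χ (mirror (d i)) (mirror (c i))
    ring : ∀ c → ℤ.- (ℤ.- + 1 - c) ≡ c ℤ.+ + 1
    ring = solve-∀

  -- Reflecting the purple window maps the mirrored α-interval onto [c i + 1, d i + 1).
  overlapP′≡overlapW′ : ∀ i j → 1 ≤ i → i ≤ ℓ → overlapP′ i j ≡ overlapW′ i j
  overlapP′≡overlapW′ i j i≥1 i≤ℓ = begin
    overlapP′ i j
      ≡⟨ sumL-cong colsP (λ x → cong (λ z → χ (mirror (d i)) z x * β⁻ x) (mirror-c≡mirror-d+len i i≥1)) ⟩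
    sumL (λ x → χ (mirror (d i)) (mirror (d i) ℤ.+ + lenα i) x * β⁻ x) colsP
      ≡⟨ sumL-χ-restrict β⁻ sP (L₂ + N₂ + 1) (mirror (d i)) (lenα i) (sP≤mirror-d i i≥1) (mirror-d+len≤endP i i≥1 i≤ℓ) ⟩
    sumL β⁻ (intRange (mirror (d i)) (lenα i))
      ≡⟨ sumL-mirror β⁻ (mirror (d i)) (lenα i) ⟩
    sumL (β⁻ ∘ mirror) (intRange (ℤ.- mirror (d i) - + lenα i) (lenα i))
      ≡⟨ cong (λ z → sumL (β⁻ ∘ mirror) (intRange z (lenα i))) start ⟩
    sumL (β⁻ ∘ mirror) (intRange (c i ℤ.+ + 1) (lenα i))
      ≡⟨ sumL-cong (intRange (c i ℤ.+ + 1) (lenα i)) (λ x → trans (χ-mirror (ℤ.- b j) (ℤ.- a j) x)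
           (cong₂ (λ u w → χ u w x) (ℤP.neg-involutive (a j)) (ℤP.neg-involutive (b j)))) ⟩
    sumL (χ (a j) (b j)) (intRange (c i ℤ.+ + 1) (lenα i))
      ≡⟨ sumL-χ-restrict (χ (a j) (b j)) sW (L₁ + N₁ + 1) (c i ℤ.+ + 1) (lenα i)
           (ℤP.≤-trans (sW≤site mα i i≤ℓ ℓ≤L₁) (ℤP.i≤i+j (c i) (+ 1)))
           (subst₂ ℤ._≤_ (sym end) refl (≤N₁+1⇒≤endW (d i ℤ.+ + 1) (ℤP.+-monoˡ-≤ (+ 1) (d≤N₁ i i≥1)))) ⟨
    sumL (λ x → χ (c i ℤ.+ + 1) (c i ℤ.+ + 1 ℤ.+ + lenα i) x * χ (a j) (b j) x) colsW
      ≡⟨ sumL-cong colsW (λ x → trans (ℕP.*-comm _ (χ (a j) (b j) x))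
           (cong (λ z → χ (a j) (b j) x * χ (c i ℤ.+ + 1) z x) end)) ⟩
    overlapW′ i j ∎
    where
    open ≡-Reasoning
    β⁻ : ℤ → ℕ
    β⁻ = χ (ℤ.- b j) (ℤ.- a j)
    start : ℤ.- mirror (d i) - + lenα i ≡ c i ℤ.+ + 1
    start rewrite d≡c+len i i≥1 = ring (c i) (+ lenα i)
      where ring : ∀ c l → ℤ.- (ℤ.- + 1 - (c ℤ.+ l)) - l ≡ c ℤ.+ + 1
            ring = solve-∀
    end : c i ℤ.+ + 1 ℤ.+ + lenα i ≡ d i ℤ.+ + 1
    end rewrite d≡c+len i i≥1 = ring (c i) (+ lenα i)
      where ring : ∀ c l → c ℤ.+ + 1 ℤ.+ l ≡ c ℤ.+ l ℤ.+ + 1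
            ring = solve-∀

  overlap-balance-entry : ∀ i j → 1 ≤ i → i ≤ ℓ → 1 ≤ j → j ≤ ℓ →
    overlapW i j + bit ⌊ c i ℤP.<? a j ⌋ ≡ bit ⌊ d i ℤP.<? b j ⌋ + overlapP i j
  overlap-balance-entry i j i≥1 i≤ℓ j≥1 j≤ℓ
    rewrite overlapW-split i j i≥1 i≤ℓ | overlapP-split i j j≥1 j≤ℓ | overlapP′≡overlapW′ i j i≥1 i≤ℓ =
    trans (swap (χ (a j) (b j) (c i)) (overlapW′ i j) (bit ⌊ c i ℤP.<? a j ⌋))
      (trans (cong (_+ overlapW′ i j) (χ-crossing (a j) (b j) (c i) (d i) (Wβ.a≤b j j≥1) (Wα.a≤b i i≥1)))
        (ℕP.+-assoc (bit ⌊ d i ℤP.<? b j ⌋) _ (overlapW′ i j)))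
    where swap : ∀ p m q → p + m + q ≡ p + q + m
          swap = NS.solve-∀

  overlap-balance : ΣΣ overlapW + ΣΣ (λ i j → bit ⌊ c i ℤP.<? a j ⌋)
                  ≡ ΣΣ (λ i j → bit ⌊ d i ℤP.<? b j ⌋) + ΣΣ overlapP
  overlap-balance = trans (sym (sumN-+ ℓ _ _)) (trans (sumN-cong ℓ (λ i i≥1 i≤ℓ → trans (sym (sumN-+ ℓ _ _))
      (trans (sumN-cong ℓ (λ j j≥1 j≤ℓ → overlap-balance-entry i j i≥1 i≤ℓ j≥1 j≤ℓ)) (sumN-+ ℓ _ _)))) (sumN-+ ℓ _ _))

  sizeα-split : sumN ℓ lenα + sumN ℓ (part mα) ≡ sumN ℓ (part lα)
  sizeα-split = trans (sym (sumN-+ ℓ _ _)) (sumN-cong ℓ (λ i i≥1 _ → ℕP.m∸n+n≡m (μα≤λα i i≥1)))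

  pair-exponent-identity : whiteExponent + purpleExponent + gPair mβ mα ≡ gPair lβ lα
  pair-exponent-identity = ℕP.+-cancelʳ-≡ (ΣΣ overlapP) _ _ (begin
    whiteExponent + purpleExponent + (sizeμ + invμ) + ΣΣ overlapP
      ≡⟨ ring₁ whiteExponent purpleExponent sizeμ invμ (ΣΣ overlapP) ⟩
    whiteExponent + (purpleExponent + ΣΣ overlapP) + sizeμ + invμ
      ≡⟨ cong₂ (λ u w → u + w + sizeμ + invμ) whiteExponent≡ΣoverlapW purpleExponent+ΣoverlapP≡Σlenα ⟩
    ΣΣ overlapW + sumN ℓ lenα + sizeμ + invμ
      ≡⟨ ring₂ (ΣΣ overlapW) (sumN ℓ lenα) sizeμ invμ ⟩
    (ΣΣ overlapW + invμ) + (sumN ℓ lenα + sizeμ)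
      ≡⟨ cong₂ _+_ overlap-balance sizeα-split ⟩
    invλ + ΣΣ overlapP + sumN ℓ (part lα)
      ≡⟨ ring₃ invλ (ΣΣ overlapP) (sumN ℓ (part lα)) ⟩
    sumN ℓ (part lα) + invλ + ΣΣ overlapP ∎)
    where
    open ≡-Reasoning
    sizeμ invμ invλ : ℕ
    sizeμ = sumN ℓ (part mα)
    invμ = ΣΣ (λ i j → bit ⌊ c i ℤP.<? a j ⌋)
    invλ = ΣΣ (λ i j → bit ⌊ d i ℤP.<? b j ⌋)
    ring₁ : ∀ t f m q y → t + f + (m + q) + y ≡ t + (f + y) + m + q
    ring₁ = NS.solve-∀
    ring₂ : ∀ x l m q → x + l + m + q ≡ (x + q) + (l + m)
    ring₂ = NS.solve-∀
    ring₃ : ∀ db y s → db + y + s ≡ s + db + y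
    ring₃ = NS.solve-∀

+-as-difference : ∀ m n o p → m + n + o ≡ p → + m ≡ (+ p - + o) - + n
+-as-difference m n o p e rewrite sym e | ℤP.pos-+ (m + n) o | ℤP.pos-+ m n = ring (+ m) (+ n) (+ o)
  where ring : ∀ m n o → m ≡ (m ℤ.+ n ℤ.+ o - o) - n
        ring = solve-∀

module BothRows {k ℓ} (lam mu : Fin k → Vec ℕ ℓ) (Pl : ∀ a → IsPartition (lam a)) (Pm : ∀ a → IsPartition (mu a))
    (HS : ∀ a → HorizontalStrip (lam a) (mu a)) (L₁ N₁ L₂ N₂ : ℕ) (ℓ≤L₁ : ℓ ≤ L₁)
    (λ≤N₁ : ∀ a i → lookup (lam a) i ≤ N₁)
    (λ≤L₂ : ∀ a i → lookup (lam a) i ≤ L₂) (μ≤L₂ : ∀ a i → lookup (mu a) i ≤ L₂) (ℓ≤N₂ : ℓ ≤ N₂) where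

  module WR = WhiteRow lam mu Pl Pm HS L₁ N₁ ℓ≤L₁ λ≤N₁
  module PR = PurpleRow lam mu Pl Pm HS L₂ N₂ λ≤L₂ μ≤L₂ ℓ≤N₂
  module PP (β α : Fin k) = ColourPair (lam β) (mu β) (lam α) (mu α) (Pl β) (Pm β) (Pl α) (Pm α) (HS β) (HS α) L₁ N₁ L₂ N₂ ℓ≤L₁ ℓ≤N₂
    (part-bound (lam β) N₁ (λ≤N₁ β)) (part-bound (lam α) N₁ (λ≤N₁ α))
    (part-bound (lam β) L₂ (λ≤L₂ β)) (part-bound (mu β) L₂ (μ≤L₂ β))
    (part-bound (lam α) L₂ (λ≤L₂ α)) (part-bound (mu α) L₂ (μ≤L₂ α))

  len : Fin k → ℕ
  len a = sumN ℓ (λ i → part (lam a) i ∸ part (mu a) i)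

  white-x-exponent : sumL WR.xExponent WR.cols ≡ ΣFin k len
  white-x-exponent = trans (sumL-ΣFin k (λ a x → WR.path a x) WR.cols) (ΣFin-cong k (λ a → PP.Σpath-white a a))

  purple-x-exponent : sumL PR.xExponent PR.cols ≡ ΣFin k len
  purple-x-exponent = trans (sumL-ΣFin k (λ a x → PR.path a x) PR.cols)
    (trans (ΣFin-cong k (λ a → PP.Σpath-purple (F.opposite a) (F.opposite a))) (ΣFin-opp k len))

  t-exponents : sumL WR.tExponent WR.cols + sumL PR.tExponent PR.cols + g mu ≡ g lam
  t-exponents = begin
    sumL WR.tExponent WR.cols + sumL PR.tExponent PR.cols + g mu
      ≡⟨ cong₂ (λ u w → u + w + g mu) (sumL-ΣPairs k _ WR.cols)
           (trans (sumL-ΣPairs k _ PR.cols) (ΣPairs-opp k (λ α β → PP.purpleExponent β α))) ⟩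
    ΣPairs k PP.whiteExponent + ΣPairs k PP.purpleExponent + g mu
      ≡⟨ trans (cong (_+ g mu) (sym (ΣPairs-+ k _ _))) (sym (ΣPairs-+ k _ _)) ⟩
    ΣPairs k (λ β α → PP.whiteExponent β α + PP.purpleExponent β α + gPair (mu β) (mu α))
      ≡⟨ ΣPairs-cong k PP.pair-exponent-identity ⟩
    g lam ∎
    where open ≡-Reasoning

  𝓛≡shifted-𝓛ᴾ : 𝓛 (asTuple lam) (asTuple mu) L₁ N₁
    ≡ shiftInvT (+ g lam - + g mu) (𝓛ᴾ (conjTuple lam) (conjTuple mu) L₂ N₂)
  𝓛≡shifted-𝓛ᴾ = begin
    𝓛 (asTuple lam) (asTuple mu) L₁ N₁
      ≡⟨ WR.white-row ⟩
    (sumL WR.xExponent WR.cols , + sumL WR.tExponent WR.cols) ∷ []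
      ≡⟨ cong (_∷ []) (cong₂ _,_ (trans white-x-exponent (sym purple-x-exponent))
                                 (+-as-difference _ _ _ _ t-exponents)) ⟩
    shiftInvT (+ g lam - + g mu) ((sumL PR.xExponent PR.cols , + sumL PR.tExponent PR.cols) ∷ [])
      ≡⟨ cong (shiftInvT (+ g lam - + g mu)) PR.purple-row ⟨
    shiftInvT (+ g lam - + g mu) (𝓛ᴾ (conjTuple lam) (conjTuple mu) L₂ N₂) ∎
    where open ≡-Reasoning

lemma4p1 : (k ℓ : ℕ) → 1 ≤ k → 1 ≤ ℓ →
    Σ ((Fin k → Vec ℕ ℓ) → ℕ) λ g →
    (lam mu : Fin k → Vec ℕ ℓ) →
    (∀ a → IsPartition (lam a)) → (∀ a → IsPartition (mu a)) →
    (∀ a → HorizontalStrip (lam a) (mu a)) →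
    (L₁ N₁ L₂ N₂ : ℕ) →
    ℓ ≤ L₁ → (∀ a i → lookup (lam a) i ≤ N₁) → (∀ a i → lookup (mu a) i ≤ N₁) →
    (∀ a i → lookup (lam a) i ≤ L₂) → (∀ a i → lookup (mu a) i ≤ L₂) → ℓ ≤ N₂ →
    𝓛 (asTuple lam) (asTuple mu) L₁ N₁
    ≈ᴾ shiftInvT (+ g lam - + g mu) (𝓛ᴾ (conjTuple lam) (conjTuple mu) L₂ N₂)
lemma4p1 k ℓ _ _ = g , λ lam mu Pl Pm HS L₁ N₁ L₂ N₂ ℓ≤L₁ λ≤N₁ _ λ≤L₂ μ≤L₂ ℓ≤N₂ a b →
  cong (λ P → coeff P a b) (BothRows.𝓛≡shifted-𝓛ᴾ lam mu Pl Pm HS L₁ N₁ L₂ N₂ ℓ≤L₁ λ≤N₁ λ≤L₂ μ≤L₂ ℓ≤N₂)
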